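{- Let $1\le i<j\le n$, $\gamma_1=\sum_{t=i}^{j-1}\alpha_t+2\sum_{t=j}^{n-1}\alpha_t+\beta$ and $\gamma_2=2\sum_{t=i}^{n-1}\alpha_t+\beta$, and let $w\in\mathbf{W}$ with $w\le w_0$, $w(\gamma_1)<0$ and $w(\gamma_2)<0$. Let $\xi\in\Sigma^+$ with $\mathrm{ht}(\gamma_1)\le\mathrm{ht}(\xi)\le\mathrm{ht}(\gamma_2)$. If $\gamma_2-\xi=\sum_t\delta_t$ is a sum of positive roots $\delta_t$, then $w(\delta_t)<0$ for at least one $t$.
   Context: $n>1$. Roots of $\mathrm{Sp}_{2n}$ with respect to the diagonal torus $t=\mathrm{diag}(a_1,\dots,a_n,a_n^{ -1},\dots,a_1^{ -1})$ and upper triangular Borel; simple roots $\alpha_i(t)=a_i/a_{i+1}$ ($1\le i\le n-1$), $\beta(t)=a_n^2$; $\Sigma^+$ positive roots; $\mathrm{ht}$ height. $\mathbf{W}$ is the Weyl group with simple reflections $s_{\alpha_i},s_\beta$ and Bruhat order $\le$; $w_0=s_{\alpha_1}\cdots s_{\alpha_{n-1}}s_\beta s_{\alpha_{n-1}}\cdots s_{\alpha_1}$. -}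

module Defs where

open import Data.Nat as ℕ using (ℕ; zero; suc)
open import Data.Integer using (ℤ; +_; -_; _+_; _-_; _*_; _≤_)
open import Data.Fin as Fin using (Fin; toℕ)
open import Data.List using (List; []; _∷_; _++_; length; reverse; drop; allFin)
open import Data.List.Relation.Binary.Sublist.Propositional using (_⊆_)
open import Data.Bool using (Bool; true; false; if_then_else_; _∨_)
open import Data.Product using (Σ; _×_; ∃; ∃-syntax)
open import Relation.Nullary using (¬_)
open import Relation.Nullary.Decidable using (⌊_⌋)
open import Relation.Binary.PropositionalEquality using (_≡_)

-- Root lattice of Sp_{2n} in the basis of simple roots.
-- Index k : Fin n (0-based): for toℕ k < n-1 it is α_{k+1}; the last index
-- (toℕ k = n-1) is β.
Lattice : ℕ → Set
Lattice n = Fin n → ℤ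

isLast : ∀ {n} → Fin n → Bool
isLast {n} k = ⌊ suc (toℕ k) ℕ.≟ n ⌋

adjacent : ∀ {n} → Fin n → Fin n → Bool
adjacent j k = ⌊ toℕ j ℕ.≟ suc (toℕ k) ⌋ ∨ ⌊ toℕ k ℕ.≟ suc (toℕ j) ⌋

-- Cartan integers ⟨σ_j , σ_k^∨⟩ for type C_n (β = 2ε_n long).
cartan : ∀ {n} → Fin n → Fin n → ℤ
cartan j k =
  if ⌊ j Fin.≟ k ⌋ then + 2
  else if adjacent j k then (if isLast j then - (+ 2) else - (+ 1))
  else + 0

∑ : ∀ {n} → (Fin n → ℤ) → ℤ
∑ {zero} f = + 0
∑ {suc n} f = f Fin.zero + ∑ (λ k → f (Fin.suc k))

pair : ∀ {n} → Lattice n → Fin n → ℤ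
pair x k = ∑ (λ j → x j * cartan j k)

simple : ∀ {n} → Fin n → Lattice n
simple k j = if ⌊ j Fin.≟ k ⌋ then + 1 else + 0

sref : ∀ {n} → Fin n → Lattice n → Lattice n
sref k x j = x j - pair x k * simple k j

-- Elements of W are given by words in the simple reflections;
-- the word k₁ ∷ k₂ ∷ … denotes s_{k₁} s_{k₂} ⋯ .
Word : ℕ → Set
Word n = List (Fin n)

act : ∀ {n} → Word n → Lattice n → Lattice n
act [] x = x
act (k ∷ w) x = sref k (act w x)

_≈_ : ∀ {n} → Lattice n → Lattice n → Set
x ≈ y = ∀ j → x j ≡ y j

_≈W_ : ∀ {n} → Word n → Word n → Set
w ≈W v = ∀ x → act w x ≈ act v x

Reduced : ∀ {n} → Word n → Set
Reduced r = ∀ u → u ≈W r → length r ℕ.≤ length u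

-- Bruhat order (subword characterization): w ≤ v iff some reduced word
-- for v contains a subword representing w.
_≤B_ : ∀ {n} → Word n → Word n → Set
w ≤B v = ∃[ r ] (r ≈W v × Reduced r × ∃[ s ] (s ⊆ r × s ≈W w))

-- w₀ = s_{α_1} ⋯ s_{α_{n-1}} s_β s_{α_{n-1}} ⋯ s_{α_1}
w0 : (n : ℕ) → Word n
w0 n = allFin n ++ drop 1 (reverse (allFin n))

Root : ∀ {n} → Lattice n → Set
Root x = ∃[ w ] ∃[ k ] (act w (simple k) ≈ x)

PosRoot : ∀ {n} → Lattice n → Set
PosRoot x = Root x × (∀ j → + 0 ≤ x j)

Neg : ∀ {n} → Lattice n → Set
Neg x = (∀ j → x j ≤ + 0) × ¬ (∀ j → x j ≡ + 0)

ht : ∀ {n} → Lattice n → ℤ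
ht x = ∑ x

sumL : ∀ {n} → List (Lattice n) → Lattice n
sumL [] j = + 0
sumL (d ∷ ds) j = d j + sumL ds j

-- γ₁ = ∑_{t=i}^{j-1} α_t + 2 ∑_{t=j}^{n-1} α_t + β, with i = toℕ I + 1, j = toℕ J + 1
γ₁ : ∀ {n} → Fin n → Fin n → Lattice n
γ₁ I J k =
  if isLast k then + 1
  else if ⌊ toℕ k ℕ.<? toℕ I ⌋ then + 0
  else if ⌊ toℕ k ℕ.<? toℕ J ⌋ then + 1
  else + 2

γ₂ : ∀ {n} → Fin n → Lattice n
γ₂ I k =
  if isLast k then + 1
  else if ⌊ toℕ k ℕ.<? toℕ I ⌋ then + 0
  else + 2

module Submission where

-- Pass from simple-root coordinates to ε-coordinates, where roots are ±ε_a ± ε_b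
-- or ±2ε_a and W acts by signed permutations of the indices.  (1) Every w ≤ w₀ has a word with
-- at most one letter s_β, since a reduced word of w₀ must spend 2(n-1) letters s_α to turn
-- 2ε_0 into -2ε_0; hence w changes the sign of at most one ε_a, and w(γ₂) < 0 forces that to
-- be ε_I.  (2) γ₂ - ξ, and so every δ_t, has no coefficient below I.  Some δ_t has a positive
-- coefficient at I, for otherwise ξ = 2ε_I = γ₂ and the nonempty sum would vanish.  (3) Such a
-- δ_t is ε_I - ε_c with c > I, or ε_I + ε_c; the latter is excluded by heights, since
-- δ_t + γ₁ - γ₂ = ε_c + ε_J would have positive height while ht δ_t ≤ ht γ₂ - ht γ₁.  And w
-- sends ε_I - ε_c to -ε_{w(I)} - ε_{w(c)} < 0.

open import Defs
open import Data.Nat as ℕ using (ℕ; zero; suc; z≤n; s≤s; _<_; _≡ᵇ_; _<ᵇ_)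
import Data.Nat.Properties as ℕP
open import Data.Integer as ℤ using (ℤ; +_; -[1+_]; -_; _+_; _-_; _*_; +≤+; -≤+; _≤_)
import Data.Integer.Properties as ℤP
open import Data.Integer.Tactic.RingSolver using (solve-∀)
open import Data.Fin as Fin using (Fin; toℕ)
import Data.Fin.Properties as FinP
open import Data.Bool using (Bool; true; false; if_then_else_; T; not; _∧_; _∨_; _xor_)
open import Data.List using (List; []; _∷_; [_]; map; length; _++_; tabulate; applyUpTo; upTo; downFrom; allFin; reverse; drop)
import Data.List.Properties as LP
open import Data.List.Relation.Binary.Sublist.Propositional using (_⊆_; []; _∷_; _∷ʳ_)
open import Data.List.Relation.Unary.All as All using (All; []; _∷_)
open import Data.List.Relation.Unary.All.Properties using (¬Any⇒All¬)
open import Data.List.Relation.Unary.Any using (Any; here; there; any?)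
open import Data.List.Membership.Propositional using (_∈_; find; lose)
open import Data.Sum using (_⊎_; inj₁; inj₂)
open import Data.Bool.Properties using (T-≡; xor-assoc)
open import Data.Unit using (tt)
open import Data.Product using (Σ; _×_; _,_; proj₁; proj₂)
open import Data.Empty using (⊥-elim)
open import Function.Bundles using (Equivalence)
open import Relation.Nullary using (¬_; yes; no)
open import Relation.Binary.Definitions using (tri<; tri≈; tri>)
open import Relation.Nullary.Decidable using (⌊_⌋; isYes≗does)
open import Relation.Binary.PropositionalEquality hiding ([_])

-- Defs tests indices with ⌊ _≟_ ⌋ and ⌊ _<?_ ⌋; these equal the
-- boolean functions _≡ᵇ_ and _<ᵇ_ (≟-≡ᵇ, <?-<ᵇ, Fin≟-≡ᵇ below), which compute by recursion
-- on ℕ.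

≡ᵇ-true : ∀ a b → (a ≡ᵇ b) ≡ true → a ≡ b
≡ᵇ-true a b e = ℕP.≡ᵇ⇒≡ a b (subst T (sym e) tt)

≡ᵇ-intro : ∀ {a b} → a ≡ b → (a ≡ᵇ b) ≡ true
≡ᵇ-intro {a} {b} e = Equivalence.to T-≡ (ℕP.≡⇒≡ᵇ a b e)

≡ᵇ-refl : ∀ a → (a ≡ᵇ a) ≡ true
≡ᵇ-refl a = ≡ᵇ-intro {a} refl

≡ᵇ-false : ∀ {a b} → a ≢ b → (a ≡ᵇ b) ≡ false
≡ᵇ-false {a} {b} a≢b with a ≡ᵇ b in e
... | false = refl
... | true = ⊥-elim (a≢b (≡ᵇ-true a b e))

≡ᵇ-false⁻ : ∀ a b → (a ≡ᵇ b) ≡ false → a ≢ b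
≡ᵇ-false⁻ a .a e refl with () ← trans (sym e) (≡ᵇ-refl a)

≡ᵇ-sym : ∀ a b → (a ≡ᵇ b) ≡ (b ≡ᵇ a)
≡ᵇ-sym zero zero = refl
≡ᵇ-sym zero (suc b) = refl
≡ᵇ-sym (suc a) zero = refl
≡ᵇ-sym (suc a) (suc b) = ≡ᵇ-sym a b

≡ᵇ-< : ∀ {a b} → a < b → (a ≡ᵇ b) ≡ false
≡ᵇ-< a<b = ≡ᵇ-false (ℕP.<⇒≢ a<b)

≡ᵇ-> : ∀ {a b} → b < a → (a ≡ᵇ b) ≡ false
≡ᵇ-> b<a = ≡ᵇ-false (ℕP.>⇒≢ b<a)

<ᵇ-true : ∀ {a b} → a < b → (a <ᵇ b) ≡ true
<ᵇ-true a<b = Equivalence.to T-≡ (ℕP.<⇒<ᵇ a<b)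

<ᵇ-false : ∀ {a b} → b ℕ.≤ a → (a <ᵇ b) ≡ false
<ᵇ-false {a} {b} b≤a with a <ᵇ b in e
... | false = refl
... | true = ⊥-elim (ℕP.<⇒≱ (ℕP.<ᵇ⇒< a b (subst T (sym e) tt)) b≤a)

Fin≟-≡ᵇ : ∀ {n} (a b : Fin n) → ⌊ a Fin.≟ b ⌋ ≡ (toℕ a ≡ᵇ toℕ b)
Fin≟-≡ᵇ a b with a Fin.≟ b
... | yes refl = sym (≡ᵇ-refl (toℕ a))
... | no a≢b = sym (≡ᵇ-false (λ e → a≢b (FinP.toℕ-injective e)))

≟-≡ᵇ : ∀ a b → ⌊ a ℕ.≟ b ⌋ ≡ (a ≡ᵇ b)
≟-≡ᵇ a b = isYes≗does (a ℕ.≟ b)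

<?-<ᵇ : ∀ a b → ⌊ a ℕ.<? b ⌋ ≡ (a <ᵇ b)
<?-<ᵇ a b = isYes≗does (a ℕ.<? b)

-- Vectors indexed by Fin n, read as sequences ℕ → ℤ that vanish from n on.  On
-- sequences, neighbouring coordinates t and suc t can be addressed directly.
extend : ∀ {n} → (Fin n → ℤ) → ℕ → ℤ
extend {zero} x m = + 0
extend {suc n} x zero = x Fin.zero
extend {suc n} x (suc m) = extend (λ j → x (Fin.suc j)) m

extend-toℕ : ∀ {n} (x : Fin n → ℤ) j → extend x (toℕ j) ≡ x j
extend-toℕ {suc n} x Fin.zero = refl
extend-toℕ {suc n} x (Fin.suc j) = extend-toℕ (λ j → x (Fin.suc j)) j

extend-fromℕ< : ∀ {n} (x : Fin n → ℤ) {t} (t<n : t < n) → extend x t ≡ x (Fin.fromℕ< t<n)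
extend-fromℕ< x {t} t<n =
  trans (cong (extend x) (sym (FinP.toℕ-fromℕ< t<n))) (extend-toℕ x (Fin.fromℕ< t<n))

extend-≥ : ∀ {n} (x : Fin n → ℤ) m → n ℕ.≤ m → extend x m ≡ + 0
extend-≥ {zero} x m n≤m = refl
extend-≥ {suc n} x (suc m) (s≤s n≤m) = extend-≥ (λ j → x (Fin.suc j)) m n≤m

extend-cong : ∀ {n} {x y : Fin n → ℤ} → (∀ j → x j ≡ y j) → ∀ m → extend x m ≡ extend y m
extend-cong {zero} x≡y m = refl
extend-cong {suc n} x≡y zero = x≡y Fin.zero
extend-cong {suc n} x≡y (suc m) = extend-cong (λ j → x≡y (Fin.suc j)) m

extend-zipWith : ∀ {n} (f : ℤ → ℤ → ℤ) → f (+ 0) (+ 0) ≡ + 0 → (x y : Fin n → ℤ) → ∀ m →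
  extend (λ j → f (x j) (y j)) m ≡ f (extend x m) (extend y m)
extend-zipWith {zero} f f00 x y m = sym f00
extend-zipWith {suc n} f f00 x y zero = refl
extend-zipWith {suc n} f f00 x y (suc m) =
  extend-zipWith f f00 (λ j → x (Fin.suc j)) (λ j → y (Fin.suc j)) m

extend-scale : ∀ {n} (x : Fin n → ℤ) (h : ℕ → ℤ) m →
  extend (λ j → x j * h (toℕ j)) m ≡ extend x m * h m
extend-scale {zero} x h m = sym (ℤP.*-zeroˡ (h m))
extend-scale {suc n} x h zero = refl
extend-scale {suc n} x h (suc m) = extend-scale (λ j → x (Fin.suc j)) (λ t → h (suc t)) m

extend-tabulate : ∀ {n} (h : ℕ → ℤ) m → extend {n} (λ j → h (toℕ j)) m ≡ (if m <ᵇ n then h m else + 0)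
extend-tabulate {zero} h m = refl
extend-tabulate {suc n} h zero = refl
extend-tabulate {suc n} h (suc m) = extend-tabulate {n} (λ t → h (suc t)) m

extend-zero : ∀ {n} (x : Fin n → ℤ) → (∀ j → x j ≡ + 0) → ∀ m → extend x m ≡ + 0
extend-zero {zero} x x≡0 m = refl
extend-zero {suc n} x x≡0 zero = x≡0 Fin.zero
extend-zero {suc n} x x≡0 (suc m) = extend-zero (λ j → x (Fin.suc j)) (λ j → x≡0 (Fin.suc j)) m

extend-formula : ∀ {n} (x : Fin n → ℤ) (h : ℕ → ℤ) → (∀ j → x j ≡ h (toℕ j)) →
  ∀ t → t < n → extend x t ≡ h t
extend-formula {n} x h x≡h t t<n = begin
  extend x t                           ≡⟨ extend-cong x≡h t ⟩
  extend {n} (λ j → h (toℕ j)) t       ≡⟨ extend-tabulate {n} h t ⟩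
  (if t <ᵇ n then h t else + 0)         ≡⟨ cong (if_then h t else + 0) (<ᵇ-true t<n) ⟩
  h t                                   ∎
  where open ≡-Reasoning

sumTo : ℕ → (ℕ → ℤ) → ℤ
sumTo zero g = + 0
sumTo (suc n) g = g 0 + sumTo n (λ t → g (suc t))

∑-extend : ∀ {n} (x : Fin n → ℤ) → ∑ x ≡ sumTo n (extend x)
∑-extend {zero} x = refl
∑-extend {suc n} x = cong (λ s → x Fin.zero + s) (∑-extend (λ j → x (Fin.suc j)))

sumTo-cong : ∀ n {g h : ℕ → ℤ} → (∀ t → g t ≡ h t) → sumTo n g ≡ sumTo n h
sumTo-cong zero g≡h = refl
sumTo-cong (suc n) g≡h = cong₂ _+_ (g≡h 0) (sumTo-cong n (λ t → g≡h (suc t)))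

sumTo-zero : ∀ n → sumTo n (λ _ → + 0) ≡ + 0
sumTo-zero zero = refl
sumTo-zero (suc n) = trans (ℤP.+-identityˡ _) (sumTo-zero n)

sumTo-- : ∀ n (g h : ℕ → ℤ) → sumTo n (λ t → g t - h t) ≡ sumTo n g - sumTo n h
sumTo-- zero g h = refl
sumTo-- (suc n) g h rewrite sumTo-- n (λ t → g (suc t)) (λ t → h (suc t)) =
  regroup (g 0) (h 0) (sumTo n (λ t → g (suc t))) (sumTo n (λ t → h (suc t)))
  where
  regroup : ∀ a b c d → a - b + (c - d) ≡ a + c - (b + d)
  regroup = solve-∀

sumTo-δ : ∀ n (g : ℕ → ℤ) m → (∀ t → n ℕ.≤ t → g t ≡ + 0) →
  sumTo n (λ t → if t ≡ᵇ m then g t else + 0) ≡ g m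
sumTo-δ zero g m g≥n = sym (g≥n m z≤n)
sumTo-δ (suc n) g zero g≥n = trans (cong (λ s → g 0 + s) (sumTo-zero n)) (ℤP.+-identityʳ (g 0))
sumTo-δ (suc n) g (suc m) g≥n =
  trans (ℤP.+-identityˡ _) (sumTo-δ n (λ t → g (suc t)) m (λ t p → g≥n (suc t) (s≤s p)))

∑-cong : ∀ {n} {f g : Fin n → ℤ} → (∀ j → f j ≡ g j) → ∑ f ≡ ∑ g
∑-cong {zero} f≡g = refl
∑-cong {suc n} f≡g = cong₂ _+_ (f≡g Fin.zero) (∑-cong (λ j → f≡g (Fin.suc j)))

∑-+ : ∀ {n} (f g : Fin n → ℤ) → ∑ (λ j → f j + g j) ≡ ∑ f + ∑ g
∑-+ {zero} f g = refl
∑-+ {suc n} f g rewrite ∑-+ (λ j → f (Fin.suc j)) (λ j → g (Fin.suc j)) =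
  regroup (f Fin.zero) (g Fin.zero) (∑ (λ j → f (Fin.suc j))) (∑ (λ j → g (Fin.suc j)))
  where
  regroup : ∀ a b c d → a + b + (c + d) ≡ a + c + (b + d)
  regroup = solve-∀

∑-- : ∀ {n} (f g : Fin n → ℤ) → ∑ (λ j → f j - g j) ≡ ∑ f - ∑ g
∑-- {zero} f g = refl
∑-- {suc n} f g rewrite ∑-- (λ j → f (Fin.suc j)) (λ j → g (Fin.suc j)) =
  regroup (f Fin.zero) (g Fin.zero) (∑ (λ j → f (Fin.suc j))) (∑ (λ j → g (Fin.suc j)))
  where
  regroup : ∀ a b c d → a - b + (c - d) ≡ a + c - (b + d)
  regroup = solve-∀

∑-mono : ∀ {n} {f g : Fin n → ℤ} → (∀ j → f j ≤ g j) → ∑ f ≤ ∑ g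
∑-mono {zero} f≤g = +≤+ z≤n
∑-mono {suc n} f≤g = ℤP.+-mono-≤ (f≤g Fin.zero) (∑-mono (λ j → f≤g (Fin.suc j)))

Nonneg : ∀ {n} → (Fin n → ℤ) → Set
Nonneg x = ∀ j → + 0 ≤ x j

∑-nonneg : ∀ {n} (f : Fin n → ℤ) → Nonneg f → + 0 ≤ ∑ f
∑-nonneg {zero} f f≥0 = +≤+ z≤n
∑-nonneg {suc n} f f≥0 = ℤP.+-mono-≤ (f≥0 Fin.zero) (∑-nonneg (λ j → f (Fin.suc j)) (λ j → f≥0 (Fin.suc j)))

∑-≥-term : ∀ {n} (f : Fin n → ℤ) → Nonneg f → ∀ j → f j ≤ ∑ f
∑-≥-term {suc n} f f≥0 Fin.zero =
  ℤP.≤-trans (ℤP.≤-reflexive (sym (ℤP.+-identityʳ (f Fin.zero))))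
             (ℤP.+-monoʳ-≤ (f Fin.zero) (∑-nonneg (λ j → f (Fin.suc j)) (λ j → f≥0 (Fin.suc j))))
∑-≥-term {suc n} f f≥0 (Fin.suc j) =
  ℤP.≤-trans (∑-≥-term (λ j → f (Fin.suc j)) (λ j → f≥0 (Fin.suc j)) j)
             (ℤP.≤-trans (ℤP.≤-reflexive (sym (ℤP.+-identityˡ _))) (ℤP.+-monoˡ-≤ _ (f≥0 Fin.zero)))

-- With α_k = ε_k - ε_{k+1} and β = 2ε_{n-1} (indices from 0), the
-- vector Σ X_k σ_k has ε_t-coefficient X_t - X_{t-1}, except for the last index,
-- where it is 2X_{n-1} - X_{n-2}.  In ε-coordinates roots are ±ε_a ± ε_b and the
-- Weyl group acts by signed permutations, which is what the argument exploits.
prev : (ℕ → ℤ) → ℕ → ℤ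
prev X zero = + 0
prev X (suc t) = X t

toε : ℕ → (ℕ → ℤ) → ℕ → ℤ
toε n X t = if suc t ≡ᵇ n then X t + X t - prev X t else X t - prev X t

εOf : ∀ {n} → Lattice n → ℕ → ℤ
εOf {n} x = toε n (extend x)

-- ⟨y, σ_k^∨⟩ for y in ε-coordinates: α_k^∨ = ε_k - ε_{k+1} and β^∨ = ε_{n-1}.
corootPair : ℕ → (ℕ → ℤ) → ℕ → ℤ
corootPair n y k = if suc k ≡ᵇ n then y k else y k - y (suc k)

cartanℕ : ℕ → ℕ → ℕ → ℤ
cartanℕ n k t = if t ≡ᵇ k then + 2 else
  (if ((t ≡ᵇ suc k) ∨ (k ≡ᵇ suc t)) then (if suc t ≡ᵇ n then - (+ 2) else - (+ 1)) else + 0)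

cartan-ℕ : ∀ {n} (j k : Fin n) → cartan j k ≡ cartanℕ n (toℕ k) (toℕ j)
cartan-ℕ {n} j k
  rewrite Fin≟-≡ᵇ j k | ≟-≡ᵇ (toℕ j) (suc (toℕ k)) | ≟-≡ᵇ (toℕ k) (suc (toℕ j))
        | ≟-≡ᵇ (suc (toℕ j)) n = refl

-- -⟨σ_{k+1}, σ_k^∨⟩: it is 2 when σ_{k+1} = β, since β is long.
longNext : ℕ → ℕ → ℤ
longNext n k = if suc (suc k) ≡ᵇ n then + 2 else + 1

cartan-row : ∀ n k t (X : ℕ → ℤ) → k < n → X t * cartanℕ n k t ≡
  (if t ≡ᵇ k then X t + X t else + 0) - (if suc t ≡ᵇ k then X t else + 0)
   - (if t ≡ᵇ suc k then longNext n k * X t else + 0)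
cartan-row n k t X k<n with t ≡ᵇ k in t≟k
... | true with ≡ᵇ-true t k t≟k
... | refl rewrite ≡ᵇ-> (ℕP.n<1+n t) | ≡ᵇ-< (ℕP.n<1+n t) = ring (X t)
  where
  ring : ∀ a → a * + 2 ≡ a + a - + 0 - + 0
  ring = solve-∀
cartan-row n k t X k<n | false with t ≡ᵇ suc k in t≟k+1
... | true with ≡ᵇ-true t (suc k) t≟k+1
... | refl rewrite ≡ᵇ-> (ℕP.n<1+n (suc k)) | ≡ᵇ-> (ℕP.m<n⇒m<1+n (ℕP.n<1+n k))
    with suc (suc k) ≡ᵇ n
... | true = ring (X (suc k))
  where
  ring : ∀ a → a * - (+ 2) ≡ + 0 - + 0 - + 2 * a
  ring = solve-∀
... | false = ring (X (suc k))
  where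
  ring : ∀ a → a * - (+ 1) ≡ + 0 - + 0 - + 1 * a
  ring = solve-∀
cartan-row n k t X k<n | false | false with k ≡ᵇ suc t in k≟t+1
... | true with ≡ᵇ-true k (suc t) k≟t+1
... | refl rewrite ≡ᵇ-refl (suc t) | ≡ᵇ-< k<n = ring (X t)
  where
  ring : ∀ a → a * - (+ 1) ≡ + 0 - a - + 0
  ring = solve-∀
cartan-row n k t X k<n | false | false | false rewrite ≡ᵇ-sym (suc t) k | k≟t+1 = ring (X t)
  where
  ring : ∀ a → a * + 0 ≡ + 0 - + 0 - + 0
  ring = solve-∀

pair-coroot : ∀ {n} (x : Lattice n) (k : Fin n) → pair x k ≡ corootPair n (εOf x) (toℕ k)
pair-coroot {n} x k = begin
  pair x k
    ≡⟨ ∑-cong (λ j → cong (x j *_) (cartan-ℕ j k)) ⟩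
  ∑ (λ j → x j * cartanℕ n κ (toℕ j))
    ≡⟨ ∑-extend (λ j → x j * cartanℕ n κ (toℕ j)) ⟩
  sumTo n (extend (λ j → x j * cartanℕ n κ (toℕ j)))
    ≡⟨ sumTo-cong n (extend-scale x (cartanℕ n κ)) ⟩
  sumTo n (λ t → X t * cartanℕ n κ t)
    ≡⟨ sumTo-cong n (λ t → cartan-row n κ t X (FinP.toℕ<n k)) ⟩
  sumTo n (λ t → diag t - below t - above t)
    ≡⟨ sumTo-- n _ above ⟩
  sumTo n (λ t → diag t - below t) - sumTo n above
    ≡⟨ cong (_- sumTo n above) (sumTo-- n diag below) ⟩
  sumTo n diag - sumTo n below - sumTo n above
    ≡⟨ cong₂ (λ a b → a - b - sumTo n above) sum-diag (sum-below κ) ⟩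
  X κ + X κ - prev X κ - sumTo n above
    ≡⟨ cong (λ c → X κ + X κ - prev X κ - c) sum-above ⟩
  X κ + X κ - prev X κ - longNext n κ * X (suc κ)
    ≡⟨ collect ⟩
  corootPair n (εOf x) κ ∎
  where
  open ≡-Reasoning
  κ : ℕ
  κ = toℕ k
  X : ℕ → ℤ
  X = extend x
  X≥n : ∀ t → n ℕ.≤ t → X t ≡ + 0
  X≥n t = extend-≥ x t
  diag below above : ℕ → ℤ
  diag t = if t ≡ᵇ κ then X t + X t else + 0
  below t = if suc t ≡ᵇ κ then X t else + 0
  above t = if t ≡ᵇ suc κ then longNext n κ * X t else + 0
  sum-diag : sumTo n diag ≡ X κ + X κ
  sum-diag = sumTo-δ n (λ t → X t + X t) κ (λ t n≤t → cong₂ _+_ (X≥n t n≤t) (X≥n t n≤t))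
  sum-below : ∀ m → sumTo n (λ t → if suc t ≡ᵇ m then X t else + 0) ≡ prev X m
  sum-below zero = sumTo-zero n
  sum-below (suc m) = sumTo-δ n X m X≥n
  sum-above : sumTo n above ≡ longNext n κ * X (suc κ)
  sum-above = sumTo-δ n (λ t → longNext n κ * X t) (suc κ)
    (λ t n≤t → trans (cong (longNext n κ *_) (X≥n t n≤t)) (ℤP.*-zeroʳ (longNext n κ)))
  collect : X κ + X κ - prev X κ - longNext n κ * X (suc κ) ≡ corootPair n (εOf x) κ
  collect with suc κ ≡ᵇ n in κ-last
  ... | true rewrite X≥n (suc κ) (ℕP.≤-reflexive (sym (≡ᵇ-true _ _ κ-last))) =
    trans (cong (λ c → X κ + X κ - prev X κ - c) (ℤP.*-zeroʳ (longNext n κ))) (ℤP.+-identityʳ _)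
  ... | false with suc (suc κ) ≡ᵇ n
  ... | true = ring (X κ) (prev X κ) (X (suc κ))
    where
    ring : ∀ a b c → a + a - b - + 2 * c ≡ a - b - (c + c - a)
    ring = solve-∀
  ... | false = ring (X κ) (prev X κ) (X (suc κ))
    where
    ring : ∀ a b c → a + a - b - + 1 * c ≡ a - b - (c - a)
    ring = solve-∀

sign : Bool → ℤ
sign true = + 1
sign false = - (+ 1)

SignedIndex : Set
SignedIndex = Bool × ℕ

unit : SignedIndex → ℕ → ℤ
unit (σ , a) t = if t ≡ᵇ a then sign σ else + 0

simpleε : ℕ → ℕ → ℕ → ℤ
simpleε n k t = if suc k ≡ᵇ n then unit (true , k) t + unit (true , k) t
                else unit (true , k) t + unit (false , suc k) t

simpleε-formula : ∀ n k t → t < n →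
  (if suc t ≡ᵇ n then (if t ≡ᵇ k then + 1 else + 0) + (if t ≡ᵇ k then + 1 else + 0) - unit (true , suc k) t
   else (if t ≡ᵇ k then + 1 else + 0) - unit (true , suc k) t) ≡ simpleε n k t
simpleε-formula n k t t<n with t ℕ.≟ k
simpleε-formula n k t t<n | yes refl rewrite ≡ᵇ-refl t | ≡ᵇ-< (ℕP.n<1+n t) with suc t ≡ᵇ n
... | true = refl
... | false = refl
simpleε-formula n k t t<n | no t≢k rewrite ≡ᵇ-false t≢k with t ℕ.≟ suc k
simpleε-formula n k .(suc k) t<n | no t≢k | yes refl
  rewrite ≡ᵇ-refl k | ≡ᵇ-< t<n with suc (suc k) ≡ᵇ n
... | true = refl
... | false = refl
simpleε-formula n k t t<n | no t≢k | no t≢k+1 rewrite ≡ᵇ-false t≢k+1 with suc t ≡ᵇ n | suc k ≡ᵇ n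
... | true | true = refl
... | true | false = refl
... | false | true = refl
... | false | false = refl

εOf-simple : ∀ {n} (k : Fin n) t → t < n → εOf (simple k) t ≡ simpleε n (toℕ k) t
εOf-simple {n} k t t<n =
  trans (cong₂ (λ s p → if suc t ≡ᵇ n then s + s - p else s - p) (extend-simple t t<n) (prev-simple t t<n))
        (simpleε-formula n κ t t<n)
  where
  κ : ℕ
  κ = toℕ k
  extend-simple : ∀ m → m < n → extend (simple k) m ≡ (if m ≡ᵇ κ then + 1 else + 0)
  extend-simple = extend-formula (simple k) (λ m → if m ≡ᵇ κ then + 1 else + 0)
    (λ j → cong (if_then + 1 else + 0) (Fin≟-≡ᵇ j k))
  prev-simple : ∀ m → m < n → prev (extend (simple k)) m ≡ unit (true , suc κ) m
  prev-simple zero m<n = refl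
  prev-simple (suc m) m<n = extend-simple m (ℕP.<-trans (ℕP.n<1+n m) m<n)

toε-cong : ∀ n {X Y : ℕ → ℤ} → (∀ m → X m ≡ Y m) → ∀ t → toε n X t ≡ toε n Y t
toε-cong n X≡Y zero rewrite X≡Y 0 = refl
toε-cong n X≡Y (suc t) rewrite X≡Y t | X≡Y (suc t) = refl

εOf-cong : ∀ {n} {x y : Lattice n} → (∀ j → x j ≡ y j) → ∀ t → εOf x t ≡ εOf y t
εOf-cong {n} x≡y = toε-cong n (extend-cong x≡y)

toε-lin : ∀ n (X Y : ℕ → ℤ) c t → toε n (λ m → X m - c * Y m) t ≡ toε n X t - c * toε n Y t
toε-lin n X Y c zero with 1 ≡ᵇ n
... | true = ring (X 0) (Y 0) c
  where
  ring : ∀ a b c → a - c * b + (a - c * b) - + 0 ≡ a + a - + 0 - c * (b + b - + 0)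
  ring = solve-∀
... | false = ring (X 0) (Y 0) c
  where
  ring : ∀ a b c → a - c * b - + 0 ≡ a - + 0 - c * (b - + 0)
  ring = solve-∀
toε-lin n X Y c (suc t) with suc (suc t) ≡ᵇ n
... | true = ring (X (suc t)) (Y (suc t)) (X t) (Y t) c
  where
  ring : ∀ a b a' b' c → a - c * b + (a - c * b) - (a' - c * b') ≡ a + a - a' - c * (b + b - b')
  ring = solve-∀
... | false = ring (X (suc t)) (Y (suc t)) (X t) (Y t) c
  where
  ring : ∀ a b a' b' c → a - c * b - (a' - c * b') ≡ a - a' - c * (b - b')
  ring = solve-∀

reflectε : ℕ → ℕ → (ℕ → ℤ) → ℕ → ℤ
reflectε n k y t = y t - corootPair n y k * simpleε n k t

εOf-sref : ∀ {n} (k : Fin n) (x : Lattice n) t → t < n →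
  εOf (sref k x) t ≡ reflectε n (toℕ k) (εOf x) t
εOf-sref {n} k x t t<n = begin
  εOf (sref k x) t
    ≡⟨ toε-cong n (extend-zipWith (λ a b → a - pair x k * b) (zero-row (pair x k)) x (simple k)) t ⟩
  toε n (λ m → extend x m - pair x k * extend (simple k) m) t
    ≡⟨ toε-lin n (extend x) (extend (simple k)) (pair x k) t ⟩
  εOf x t - pair x k * εOf (simple k) t
    ≡⟨ cong₂ (λ a b → εOf x t - a * b) (pair-coroot x k) (εOf-simple k t t<n) ⟩
  reflectε n (toℕ k) (εOf x) t ∎
  where
  open ≡-Reasoning
  zero-row : ∀ c → + 0 - c * + 0 ≡ + 0
  zero-row = solve-∀

-- The action of s_k on signed indices: s_{α_k} swaps k and k + 1, and s_β
-- changes the sign of ε_{n-1}.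
flipsAt : ℕ → ℕ → ℕ → Bool
flipsAt n k a = (suc k ≡ᵇ n) ∧ (a ≡ᵇ k)

movesTo : ℕ → ℕ → ℕ → ℕ
movesTo n k a =
  if suc k ≡ᵇ n then a else (if a ≡ᵇ k then suc k else (if a ≡ᵇ suc k then k else a))

reflectIndex : ℕ → ℕ → SignedIndex → SignedIndex
reflectIndex n k (σ , a) = (flipsAt n k a xor σ , movesTo n k a)

sign-not : ∀ σ → sign (not σ) ≡ - sign σ
sign-not true = refl
sign-not false = refl

reflectε-unit : ∀ n k σ a t → reflectε n k (unit (σ , a)) t ≡ unit (reflectIndex n k (σ , a)) t
reflectε-unit n k σ a t with suc k ≡ᵇ n
reflectε-unit n k σ a t | true with a ≡ᵇ k in a≟k
reflectε-unit n k σ a t | true | true with ≡ᵇ-true a k a≟k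
... | refl rewrite ≡ᵇ-refl a with t ≡ᵇ a
... | true rewrite sign-not σ = ring (sign σ)
  where
  ring : ∀ s → s - s * (+ 1 + + 1) ≡ - s
  ring = solve-∀
... | false = ring (sign σ)
  where
  ring : ∀ s → + 0 - s * (+ 0 + + 0) ≡ + 0
  ring = solve-∀
reflectε-unit n k σ a t | true | false rewrite ≡ᵇ-sym k a | a≟k = ring (unit (σ , a) t) (unit (true , k) t)
  where
  ring : ∀ x y → x - + 0 * (y + y) ≡ x
  ring = solve-∀
reflectε-unit n k σ a t | false with a ≡ᵇ k in a≟k
reflectε-unit n k σ a t | false | true with ≡ᵇ-true a k a≟k
... | refl rewrite ≡ᵇ-refl a | ≡ᵇ-sym (suc a) a | ≡ᵇ-< (ℕP.n<1+n a) with t ≡ᵇ a in t≟a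
... | true with ≡ᵇ-true t a t≟a
... | refl rewrite ≡ᵇ-< (ℕP.n<1+n t) = ring (sign σ)
  where
  ring : ∀ s → s - (s - + 0) * (+ 1 + + 0) ≡ + 0
  ring = solve-∀
reflectε-unit n k σ a t | false | true | refl | false with t ≡ᵇ suc a
... | true = ring (sign σ)
  where
  ring : ∀ s → + 0 - (s - + 0) * (+ 0 + - (+ 1)) ≡ s
  ring = solve-∀
... | false = ring (sign σ)
  where
  ring : ∀ s → + 0 - (s - + 0) * (+ 0 + + 0) ≡ + 0
  ring = solve-∀
reflectε-unit n k σ a t | false | false rewrite ≡ᵇ-sym k a | a≟k with a ≡ᵇ suc k in a≟k+1
... | true with ≡ᵇ-true a (suc k) a≟k+1
... | refl rewrite ≡ᵇ-refl a with t ≡ᵇ k in t≟k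
... | true with ≡ᵇ-true t k t≟k
... | refl rewrite ≡ᵇ-< (ℕP.n<1+n t) = ring (sign σ)
  where
  ring : ∀ s → + 0 - (+ 0 - s) * (+ 1 + + 0) ≡ s
  ring = solve-∀
reflectε-unit n k σ (suc k) t | false | false | true | refl | false with t ≡ᵇ suc k
... | true = ring (sign σ)
  where
  ring : ∀ s → s - (+ 0 - s) * (+ 0 + - (+ 1)) ≡ + 0
  ring = solve-∀
... | false = ring (sign σ)
  where
  ring : ∀ s → + 0 - (+ 0 - s) * (+ 0 + + 0) ≡ + 0
  ring = solve-∀
reflectε-unit n k σ a t | false | false | false rewrite ≡ᵇ-sym (suc k) a | a≟k+1 =
  ring (unit (σ , a) t) (simpleε n k t)
  where
  ring : ∀ x y → x - (+ 0 - + 0) * y ≡ x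
  ring = solve-∀

corootPair-+ : ∀ n k (y z : ℕ → ℤ) → corootPair n (λ m → y m + z m) k ≡ corootPair n y k + corootPair n z k
corootPair-+ n k y z with suc k ≡ᵇ n
... | true = refl
... | false = ring (y k) (z k) (y (suc k)) (z (suc k))
  where
  ring : ∀ c d c' d' → c + d - (c' + d') ≡ c - c' + (d - d')
  ring = solve-∀

reflectε-+ : ∀ n k (y z : ℕ → ℤ) t → reflectε n k (λ m → y m + z m) t ≡ reflectε n k y t + reflectε n k z t
reflectε-+ n k y z t rewrite corootPair-+ n k y z =
  ring (y t) (z t) (corootPair n y k) (corootPair n z k) (simpleε n k t)
  where
  ring : ∀ a b c d e → a + b - (c + d) * e ≡ a - c * e + (b - d * e)
  ring = solve-∀

suc-<-last : ∀ n k → k < n → (suc k ≡ᵇ n) ≡ false → suc k < n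
suc-<-last n k k<n not-last with ℕP.m≤n⇒m<n∨m≡n k<n
... | inj₁ k+1<n = k+1<n
... | inj₂ k+1≡n = ⊥-elim (≡ᵇ-false⁻ _ _ not-last k+1≡n)

reflectε-cong : ∀ n k {y z : ℕ → ℤ} → k < n → (∀ t → t < n → y t ≡ z t) →
  ∀ t → t < n → reflectε n k y t ≡ reflectε n k z t
reflectε-cong n k k<n y≡z t t<n with suc k ≡ᵇ n in last?
... | true rewrite y≡z t t<n | y≡z k k<n = refl
... | false rewrite y≡z t t<n | y≡z k k<n | y≡z (suc k) (suc-<-last n k k<n last?) = refl

Indices : Set
Indices = List ℕ

toIndices : ∀ {n} → Word n → Indices
toIndices = map toℕ

actIndex : ℕ → Indices → SignedIndex → SignedIndex
actIndex n [] p = p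
actIndex n (k ∷ l) p = reflectIndex n k (actIndex n l p)

εOf-act : ∀ {n} (w : Word n) (x : Lattice n) p q →
  (∀ t → t < n → εOf x t ≡ unit p t + unit q t) →
  ∀ t → t < n → εOf (act w x) t ≡ unit (actIndex n (toIndices w) p) t + unit (actIndex n (toIndices w) q) t
εOf-act [] x p q x≡pq t t<n = x≡pq t t<n
εOf-act {n} (k ∷ w) x p q x≡pq t t<n = begin
  εOf (sref k (act w x)) t
    ≡⟨ εOf-sref k (act w x) t t<n ⟩
  reflectε n (toℕ k) (εOf (act w x)) t
    ≡⟨ reflectε-cong n (toℕ k) (FinP.toℕ<n k) (εOf-act w x p q x≡pq) t t<n ⟩
  reflectε n (toℕ k) (λ m → unit p′ m + unit q′ m) t
    ≡⟨ reflectε-+ n (toℕ k) (unit p′) (unit q′) t ⟩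
  reflectε n (toℕ k) (unit p′) t + reflectε n (toℕ k) (unit q′) t
    ≡⟨ cong₂ _+_ (reflectε-unit n (toℕ k) (proj₁ p′) (proj₂ p′) t) (reflectε-unit n (toℕ k) (proj₁ q′) (proj₂ q′) t) ⟩
  unit (reflectIndex n (toℕ k) p′) t + unit (reflectIndex n (toℕ k) q′) t ∎
  where
  open ≡-Reasoning
  p′ : SignedIndex
  p′ = actIndex n (toIndices w) p
  q′ : SignedIndex
  q′ = actIndex n (toIndices w) q

position : ℕ → Indices → ℕ → ℕ
position n [] a = a
position n (k ∷ l) a = movesTo n k (position n l a)

signFlip : ℕ → Indices → ℕ → Bool
signFlip n [] a = false
signFlip n (k ∷ l) a = flipsAt n k (position n l a) xor signFlip n l a

actIndex-split : ∀ n l σ a → actIndex n l (σ , a) ≡ (signFlip n l a xor σ , position n l a)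
actIndex-split n [] σ a = refl
actIndex-split n (k ∷ l) σ a rewrite actIndex-split n l σ a =
  cong (_, position n (k ∷ l) a) (sym (xor-assoc (flipsAt n k (position n l a)) (signFlip n l a) σ))

movesTo-< : ∀ n k a → k < n → a < n → movesTo n k a < n
movesTo-< n k a k<n a<n with suc k ≡ᵇ n in last?
... | true = a<n
... | false with a ≡ᵇ k
... | true = suc-<-last n k k<n last?
... | false with a ≡ᵇ suc k
... | true = k<n
... | false = a<n

movesTo-injective : ∀ n k a b → movesTo n k a ≡ movesTo n k b → a ≡ b
movesTo-injective n k a b eq with suc k ≡ᵇ n
... | true = eq
... | false with a ≡ᵇ k in a≟k | b ≡ᵇ k in b≟k
... | true | true = trans (≡ᵇ-true a k a≟k) (sym (≡ᵇ-true b k b≟k))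
... | true | false with b ≡ᵇ suc k in b≟k+1
...   | true = ⊥-elim (ℕP.<-irrefl (sym eq) (ℕP.n<1+n k))
...   | false = ⊥-elim (≡ᵇ-false⁻ b (suc k) b≟k+1 (sym eq))
movesTo-injective n k a b eq | false | false | true with a ≡ᵇ suc k in a≟k+1
...   | true = ⊥-elim (ℕP.<-irrefl eq (ℕP.n<1+n k))
...   | false = ⊥-elim (≡ᵇ-false⁻ a (suc k) a≟k+1 eq)
movesTo-injective n k a b eq | false | false | false with a ≡ᵇ suc k in a≟k+1 | b ≡ᵇ suc k in b≟k+1
... | true | true = trans (≡ᵇ-true a (suc k) a≟k+1) (sym (≡ᵇ-true b (suc k) b≟k+1))
... | true | false = ⊥-elim (≡ᵇ-false⁻ b k b≟k (sym eq))
... | false | true = ⊥-elim (≡ᵇ-false⁻ a k a≟k eq)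
... | false | false = eq

movesTo-≤ : ∀ n k a → movesTo n k a ℕ.≤ suc a
movesTo-≤ n k a with suc k ≡ᵇ n
... | true = ℕP.n≤1+n a
... | false with a ≡ᵇ k in a≟k
... | true rewrite ≡ᵇ-true a k a≟k = ℕP.≤-refl
... | false with a ≡ᵇ suc k in a≟k+1
... | true rewrite ≡ᵇ-true a (suc k) a≟k+1 = ℕP.≤-trans (ℕP.n≤1+n k) (ℕP.n≤1+n (suc k))
... | false = ℕP.n≤1+n a

movesTo-≥ : ∀ n k a → a ℕ.≤ suc (movesTo n k a)
movesTo-≥ n k a with suc k ≡ᵇ n
... | true = ℕP.n≤1+n a
... | false with a ≡ᵇ k in a≟k
... | true rewrite ≡ᵇ-true a k a≟k = ℕP.≤-trans (ℕP.n≤1+n k) (ℕP.n≤1+n (suc k))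
... | false with a ≡ᵇ suc k in a≟k+1
... | true rewrite ≡ᵇ-true a (suc k) a≟k+1 = ℕP.≤-refl
... | false = ℕP.n≤1+n a

position-injective : ∀ n l a b → position n l a ≡ position n l b → a ≡ b
position-injective n [] a b eq = eq
position-injective n (k ∷ l) a b eq = position-injective n l a b (movesTo-injective n k _ _ eq)

position-< : ∀ {n} (w : Word n) a → a < n → position n (toIndices w) a < n
position-< [] a a<n = a<n
position-< {n} (k ∷ w) a a<n = movesTo-< n (toℕ k) _ (FinP.toℕ<n k) (position-< w a a<n)

βCount : ℕ → Indices → ℕ
βCount n [] = 0
βCount n (k ∷ l) = (if suc k ≡ᵇ n then 1 else 0) ℕ.+ βCount n l

αCount : ℕ → Indices → ℕ
αCount n [] = 0
αCount n (k ∷ l) = (if suc k ≡ᵇ n then 0 else 1) ℕ.+ αCount n l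

length-αβ : ∀ n l → length l ≡ αCount n l ℕ.+ βCount n l
length-αβ n [] = refl
length-αβ n (k ∷ l) with suc k ≡ᵇ n
... | true = trans (cong suc (length-αβ n l)) (sym (ℕP.+-suc (αCount n l) (βCount n l)))
... | false = cong suc (length-αβ n l)

no-β-no-flip : ∀ n l a → βCount n l ≡ 0 → signFlip n l a ≡ false
no-β-no-flip n [] a no-β = refl
no-β-no-flip n (k ∷ l) a no-β with suc k ≡ᵇ n
... | true = ⊥-elim (ℕP.1+n≢0 no-β)
... | false = no-β-no-flip n l a no-β

flip-unique : ∀ n l a b → βCount n l ℕ.≤ 1 → a ≢ b → signFlip n l a ≡ true → signFlip n l b ≡ false
flip-unique n [] a b one-β a≢b ()
flip-unique n (k ∷ l) a b one-β a≢b a-flips with suc k ≡ᵇ n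
... | false = flip-unique n l a b one-β a≢b a-flips
... | true rewrite no-β-no-flip n l a (ℕP.n≤0⇒n≡0 (ℕP.≤-pred one-β))
                 | no-β-no-flip n l b (ℕP.n≤0⇒n≡0 (ℕP.≤-pred one-β))
    with position n l a ≡ᵇ k in pa≟k | position n l b ≡ᵇ k in pb≟k
... | true | true = ⊥-elim (a≢b (position-injective n l a b
                      (trans (≡ᵇ-true _ _ pa≟k) (sym (≡ᵇ-true _ _ pb≟k)))))
... | _ | false = refl

displacement : ∀ n l a → position n l a ℕ.≤ a ℕ.+ αCount n l × a ℕ.≤ position n l a ℕ.+ αCount n l
displacement n [] a = ℕP.≤-reflexive (sym (ℕP.+-identityʳ a)) , ℕP.≤-reflexive (sym (ℕP.+-identityʳ a))
displacement n (k ∷ l) a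
  with suc k ≡ᵇ n | movesTo-≤ n k (position n l a) | movesTo-≥ n k (position n l a) | displacement n l a
... | true | _ | _ | bounds = bounds
... | false | up | down | (p≤ , ≤p) =
  ℕP.≤-trans up (ℕP.≤-trans (s≤s p≤) (ℕP.≤-reflexive (sym (ℕP.+-suc a (αCount n l))))) ,
  ℕP.≤-trans ≤p (ℕP.≤-trans (ℕP.+-monoˡ-≤ (αCount n l) down)
                            (ℕP.≤-reflexive (sym (ℕP.+-suc _ (αCount n l)))))

-- An index can only change sign at position n - 1 = m; travelling from a to m and
-- back to its final position costs at least (m - a) + (m - position) letters s_α.
flip-cost : ∀ n m l a → n ≡ suc m → signFlip n l a ≡ true →
  m ℕ.+ m ℕ.≤ a ℕ.+ position n l a ℕ.+ αCount n l
flip-cost n m [] a n≡m+1 ()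
flip-cost n m (k ∷ l) a n≡m+1 a-flips
  with suc k ≡ᵇ n in k-last | movesTo-≥ n k (position n l a) | displacement n l a
... | false | down | _ =
  ℕP.≤-trans (flip-cost n m l a n≡m+1 a-flips)
    (ℕP.≤-trans (ℕP.+-monoˡ-≤ (αCount n l) (ℕP.+-monoʳ-≤ a down)) (ℕP.≤-reflexive (shift a _ (αCount n l))))
  where
  shift : ∀ a x b → a ℕ.+ suc x ℕ.+ b ≡ a ℕ.+ x ℕ.+ suc b
  shift a x b rewrite ℕP.+-suc a x | ℕP.+-suc (a ℕ.+ x) b = refl
... | true | _ | (p≤ , _) with position n l a ≡ᵇ k in pa≟k | signFlip n l a in flipped
...   | false | _ = flip-cost n m l a n≡m+1 (trans flipped a-flips)
...   | true | false =
  ℕP.≤-trans (ℕP.≤-reflexive (cong (m ℕ.+_) (sym pa≡m)))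
    (ℕP.≤-trans (ℕP.+-monoˡ-≤ (position n l a) (subst (ℕ._≤ a ℕ.+ αCount n l) pa≡m p≤))
                (ℕP.≤-reflexive (swap a (position n l a) (αCount n l))))
  where
  pa≡m : position n l a ≡ m
  pa≡m = ℕP.suc-injective (trans (cong suc (≡ᵇ-true _ _ pa≟k)) (trans (≡ᵇ-true _ _ k-last) n≡m+1))
  swap : ∀ a x b → a ℕ.+ b ℕ.+ x ≡ a ℕ.+ x ℕ.+ b
  swap a x b rewrite ℕP.+-assoc a b x | ℕP.+-comm b x | ℕP.+-assoc a x b = refl

-- Recovering coordinates from ε-coordinates: the coefficient of σ_t is the partial
-- sum y_0 + … + y_t of the ε-coordinates, doubled for t = n - 1 (β = 2ε_{n-1}).
partialSum : (ℕ → ℤ) → ℕ → ℤ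
partialSum y zero = y 0
partialSum y (suc t) = partialSum y t + y (suc t)

scaleLast : ℕ → ℕ → ℤ → ℤ
scaleLast n t c = if suc t ≡ᵇ n then c + c else c

partialSum-toε : ∀ n (X : ℕ → ℤ) t → suc t < n → X t ≡ partialSum (toε n X) t
partialSum-toε n X zero 1<n rewrite ≡ᵇ-< 1<n = sym (ℤP.+-identityʳ (X 0))
partialSum-toε n X (suc t) t+2<n
  rewrite ≡ᵇ-< t+2<n | sym (partialSum-toε n X t (ℕP.<-trans (ℕP.n<1+n (suc t)) t+2<n)) = telescope (X t) (X (suc t))
  where
  telescope : ∀ a b → b ≡ a + (b - a)
  telescope = solve-∀

scaleLast-toε : ∀ n (X : ℕ → ℤ) t → t < n → scaleLast n t (X t) ≡ partialSum (toε n X) t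
scaleLast-toε n X t t<n with suc t ≡ᵇ n in last?
... | false = partialSum-toε n X t (suc-<-last n t t<n last?)
scaleLast-toε n X zero t<n | true rewrite last? = sym (ℤP.+-identityʳ _)
scaleLast-toε n X (suc t) t<n | true
  rewrite last? | sym (partialSum-toε n X t (ℕP.≤-reflexive (≡ᵇ-true _ _ last?))) = telescope (X t) (X (suc t))
  where
  telescope : ∀ a b → b + b ≡ a + (b + b - a)
  telescope = solve-∀

toε-partialSum : ∀ n (X y : ℕ → ℤ) → (∀ t → t < n → scaleLast n t (X t) ≡ partialSum y t) →
  ∀ t → t < n → toε n X t ≡ y t
toε-partialSum n X y X≡ zero 0<n with 1 ≡ᵇ n | X≡ 0 0<n
... | true | X0≡ rewrite X0≡ = ℤP.+-identityʳ _
... | false | X0≡ rewrite X0≡ = ℤP.+-identityʳ _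
toε-partialSum n X y X≡ (suc t) t+1<n
  with suc (suc t) ≡ᵇ n | X≡ (suc t) t+1<n | X≡ t (ℕP.<-trans (ℕP.n<1+n t) t+1<n)
... | true | Xt+1≡ | Xt≡ rewrite Xt+1≡ | ≡ᵇ-< t+1<n | Xt≡ = telescope (partialSum y t) (y (suc t))
  where
  telescope : ∀ a b → a + b - a ≡ b
  telescope = solve-∀
... | false | Xt+1≡ | Xt≡ rewrite Xt+1≡ | ≡ᵇ-< t+1<n | Xt≡ = telescope (partialSum y t) (y (suc t))
  where
  telescope : ∀ a b → a + b - a ≡ b
  telescope = solve-∀

partialSum-cong : ∀ n {y z : ℕ → ℤ} → (∀ t → t < n → y t ≡ z t) → ∀ t → t < n → partialSum y t ≡ partialSum z t
partialSum-cong n y≡z zero t<n = y≡z 0 t<n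
partialSum-cong n y≡z (suc t) t<n =
  cong₂ _+_ (partialSum-cong n y≡z t (ℕP.<-trans (ℕP.n<1+n t) t<n)) (y≡z (suc t) t<n)

partialSum-+ : ∀ (y z : ℕ → ℤ) t → partialSum (λ m → y m + z m) t ≡ partialSum y t + partialSum z t
partialSum-+ y z zero = refl
partialSum-+ y z (suc t) rewrite partialSum-+ y z t =
  regroup (partialSum y t) (partialSum z t) (y (suc t)) (z (suc t))
  where
  regroup : ∀ a b c d → a + b + (c + d) ≡ a + c + (b + d)
  regroup = solve-∀

partialSum-unit-< : ∀ σ a t → t < a → partialSum (unit (σ , a)) t ≡ + 0
partialSum-unit-< σ a zero 0<a rewrite ≡ᵇ-< 0<a = refl
partialSum-unit-< σ a (suc t) t+1<a
  rewrite partialSum-unit-< σ a t (ℕP.<-trans (ℕP.n<1+n t) t+1<a) | ≡ᵇ-< t+1<a = refl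

partialSum-unit-≥ : ∀ σ a t → a ℕ.≤ t → partialSum (unit (σ , a)) t ≡ sign σ
partialSum-unit-≥ σ zero zero a≤t = refl
partialSum-unit-≥ σ a (suc t) a≤t with a ℕ.≟ suc t
... | yes refl rewrite partialSum-unit-< σ (suc t) t (ℕP.n<1+n t) | ≡ᵇ-refl t = ℤP.+-identityˡ _
... | no a≢t+1 rewrite partialSum-unit-≥ σ a t (ℕP.≤-pred (ℕP.≤∧≢⇒< a≤t a≢t+1))
                     | ≡ᵇ-false (λ e → a≢t+1 (sym e)) = ℤP.+-identityʳ _

partialSum-unit-sign : ∀ σ a t → partialSum (unit (σ , a)) t ≡ + 0 ⊎ partialSum (unit (σ , a)) t ≡ sign σ
partialSum-unit-sign σ a t with ℕP.<-cmp t a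
... | tri< t<a _ _ = inj₁ (partialSum-unit-< σ a t t<a)
... | tri≈ _ refl _ = inj₂ (partialSum-unit-≥ σ a t ℕP.≤-refl)
... | tri> _ _ a<t = inj₂ (partialSum-unit-≥ σ a t (ℕP.<⇒≤ a<t))

partialSum-unit-≥0 : ∀ a t → + 0 ≤ partialSum (unit (true , a)) t
partialSum-unit-≥0 a t with partialSum-unit-sign true a t
... | inj₁ ≡0 = ℤP.≤-reflexive (sym ≡0)
... | inj₂ ≡1 rewrite ≡1 = +≤+ z≤n

partialSum-unit-≤0 : ∀ a t → partialSum (unit (false , a)) t ≤ + 0
partialSum-unit-≤0 a t with partialSum-unit-sign false a t
... | inj₁ ≡0 = ℤP.≤-reflexive ≡0
... | inj₂ ≡-1 rewrite ≡-1 = -≤+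

double-injective : ∀ a b → a + a ≡ b + b → a ≡ b
double-injective a b eq with ℤP.<-cmp a b
... | tri< a<b _ _ = ⊥-elim (ℤP.<-irrefl eq (ℤP.+-mono-< a<b a<b))
... | tri≈ _ a≡b _ = a≡b
... | tri> _ _ b<a = ⊥-elim (ℤP.<-irrefl (sym eq) (ℤP.+-mono-< b<a b<a))

scaleLast-injective : ∀ n t {a b} → scaleLast n t a ≡ scaleLast n t b → a ≡ b
scaleLast-injective n t {a} {b} eq with suc t ≡ᵇ n
... | true = double-injective a b eq
... | false = eq

scaleLast-≥0 : ∀ n t c → + 0 ≤ scaleLast n t c → + 0 ≤ c
scaleLast-≥0 n t c 0≤ with suc t ≡ᵇ n
... | false = 0≤
... | true = halve c 0≤
  where
  halve : ∀ c → + 0 ≤ c + c → + 0 ≤ c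
  halve (+ k) _ = +≤+ z≤n
  halve -[1+ k ] ()

scaleLast-≤0 : ∀ n t c → scaleLast n t c ≤ + 0 → c ≤ + 0
scaleLast-≤0 n t c ≤0 with suc t ≡ᵇ n
... | false = ≤0
... | true = halve c ≤0
  where
  halve : ∀ c → c + c ≤ + 0 → c ≤ + 0
  halve (+ zero) _ = +≤+ z≤n
  halve (+ suc k) (+≤+ ())
  halve -[1+ k ] _ = -≤+

scaleLast-εOf : ∀ {n} (x : Lattice n) j → scaleLast n (toℕ j) (x j) ≡ partialSum (εOf x) (toℕ j)
scaleLast-εOf {n} x j =
  trans (cong (scaleLast n (toℕ j)) (sym (extend-toℕ x j))) (scaleLast-toε n (extend x) (toℕ j) (FinP.toℕ<n j))

εOf-injective : ∀ {n} (x y : Lattice n) → (∀ t → t < n → εOf x t ≡ εOf y t) → ∀ j → x j ≡ y j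
εOf-injective {n} x y εx≡εy j = scaleLast-injective n (toℕ j) (begin
  scaleLast n (toℕ j) (x j)      ≡⟨ scaleLast-εOf x j ⟩
  partialSum (εOf x) (toℕ j)     ≡⟨ partialSum-cong n εx≡εy (toℕ j) (FinP.toℕ<n j) ⟩
  partialSum (εOf y) (toℕ j)     ≡⟨ sym (scaleLast-εOf y j) ⟩
  scaleLast n (toℕ j) (y j)      ∎)
  where open ≡-Reasoning

εPair : ∀ {n} → Lattice n → SignedIndex → SignedIndex → Set
εPair {n} x p q = ∀ t → t < n → εOf x t ≡ unit p t + unit q t

scaleLast-εPair : ∀ {n} {x : Lattice n} {p q} → εPair x p q → ∀ j →
  scaleLast n (toℕ j) (x j) ≡ partialSum (unit p) (toℕ j) + partialSum (unit q) (toℕ j)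
scaleLast-εPair {n} {x} {p} {q} x≡pq j = begin
  scaleLast n (toℕ j) (x j)                        ≡⟨ scaleLast-εOf x j ⟩
  partialSum (εOf x) (toℕ j)                       ≡⟨ partialSum-cong n x≡pq (toℕ j) (FinP.toℕ<n j) ⟩
  partialSum (λ m → unit p m + unit q m) (toℕ j)   ≡⟨ partialSum-+ (unit p) (unit q) (toℕ j) ⟩
  partialSum (unit p) (toℕ j) + partialSum (unit q) (toℕ j) ∎
  where open ≡-Reasoning

lastIndex : ∀ {n a} → a < n → Σ (Fin n) λ j → suc (toℕ j) ≡ n
lastIndex {suc m} _ = Fin.fromℕ m , cong suc (FinP.toℕ-fromℕ m)

last-coefficient : ∀ {n} {x : Lattice n} σ {a b} → a < n → b < n → εPair x (σ , a) (σ , b) →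
  ∀ j → suc (toℕ j) ≡ n → x j ≡ sign σ
last-coefficient {n} {x} σ {a} {b} a<n b<n x≡ab j last = double-injective (x j) (sign σ) (begin
  x j + x j                                    ≡⟨ sym (cong (λ l → if l then x j + x j else x j) (≡ᵇ-intro last)) ⟩
  scaleLast n (toℕ j) (x j)                    ≡⟨ scaleLast-εPair {p = σ , a} {q = σ , b} x≡ab j ⟩
  partialSum (unit (σ , a)) (toℕ j) + partialSum (unit (σ , b)) (toℕ j)
    ≡⟨ cong₂ _+_ (partialSum-unit-≥ σ a (toℕ j) (below a<n)) (partialSum-unit-≥ σ b (toℕ j) (below b<n)) ⟩
  sign σ + sign σ                              ∎)
  where
  open ≡-Reasoning
  below : ∀ {c} → c < n → c ℕ.≤ toℕ j
  below c<n = ℕP.≤-pred (subst (_ <_) (sym last) c<n)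

negative-εPair : ∀ {n} (x : Lattice n) {a b} → a < n → b < n → εPair x (false , a) (false , b) → Neg x
negative-εPair {n} x a<n b<n x≡ab = nonpositive , nonzero
  where
  nonpositive : ∀ j → x j ≤ + 0
  nonpositive j = scaleLast-≤0 n (toℕ j) (x j) (subst (_≤ + 0) (sym (scaleLast-εPair {p = false , _} {q = false , _} x≡ab j))
    (ℤP.+-mono-≤ (partialSum-unit-≤0 _ (toℕ j)) (partialSum-unit-≤0 _ (toℕ j))))
  nonzero : ¬ (∀ j → x j ≡ + 0)
  nonzero x≡0 with lastIndex a<n
  ... | j , last with () ← trans (sym (x≡0 j)) (last-coefficient false a<n b<n x≡ab j last)

positive-εPair : ∀ {n} (x : Lattice n) {a b} → a < n → b < n → εPair x (true , a) (true , b) →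
  Nonneg x × + 1 ≤ ht x
positive-εPair {n} x a<n b<n x≡ab = nonnegative , height
  where
  nonnegative : Nonneg x
  nonnegative j = scaleLast-≥0 n (toℕ j) (x j) (subst (+ 0 ≤_) (sym (scaleLast-εPair {p = true , _} {q = true , _} x≡ab j))
    (ℤP.+-mono-≤ (partialSum-unit-≥0 _ (toℕ j)) (partialSum-unit-≥0 _ (toℕ j))))
  height : + 1 ≤ ht x
  height with lastIndex a<n
  ... | j , last = subst (_≤ ht x) (last-coefficient true a<n b<n x≡ab j last) (∑-≥-term x nonnegative j)

-- Roots in ε-coordinates: every root is ε_p + ε_q with positions below n that are
-- either distinct (the roots ±ε_a ± ε_b) or carry equal signs (the roots ±2ε_a).
record RootForm {n} (x : Lattice n) : Set where
  constructor rootForm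
  field
    p q : SignedIndex
    distinct-or-equal : proj₂ p ≢ proj₂ q ⊎ p ≡ q
    p<n : proj₂ p < n
    q<n : proj₂ q < n
    coordinates : εPair x p q

simple-form : ∀ {n} (k : Fin n) → RootForm (simple k)
simple-form {n} k with suc (toℕ k) ≡ᵇ n in last?
... | true = rootForm (true , toℕ k) (true , toℕ k) (inj₂ refl) (FinP.toℕ<n k) (FinP.toℕ<n k) coordinates
  where
  coordinates : εPair (simple k) (true , toℕ k) (true , toℕ k)
  coordinates t t<n = trans (εOf-simple k t t<n)
    (cong (λ l → if l then unit (true , toℕ k) t + unit (true , toℕ k) t
                 else unit (true , toℕ k) t + unit (false , suc (toℕ k)) t) last?)
... | false = rootForm (true , toℕ k) (false , suc (toℕ k)) (inj₁ (ℕP.<⇒≢ (ℕP.n<1+n (toℕ k))))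
                (FinP.toℕ<n k) (suc-<-last n (toℕ k) (FinP.toℕ<n k) last?) coordinates
  where
  coordinates : εPair (simple k) (true , toℕ k) (false , suc (toℕ k))
  coordinates t t<n = trans (εOf-simple k t t<n)
    (cong (λ l → if l then unit (true , toℕ k) t + unit (true , toℕ k) t
                 else unit (true , toℕ k) t + unit (false , suc (toℕ k)) t) last?)

act-form : ∀ {n} (w : Word n) {x : Lattice n} → RootForm x → RootForm (act w x)
act-form {n} w (rootForm (σ , a) (τ , b) distinct-or-equal a<n b<n coordinates) =
  rootForm (actIndex n l (σ , a)) (actIndex n l (τ , b)) (still distinct-or-equal)
    (subst (_< n) (sym (cong proj₂ (actIndex-split n l σ a))) (position-< w a a<n))
    (subst (_< n) (sym (cong proj₂ (actIndex-split n l τ b))) (position-< w b b<n))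
    (εOf-act w _ (σ , a) (τ , b) coordinates)
  where
  l : Indices
  l = toIndices w
  still : a ≢ b ⊎ (σ , a) ≡ (τ , b) →
    proj₂ (actIndex n l (σ , a)) ≢ proj₂ (actIndex n l (τ , b)) ⊎ actIndex n l (σ , a) ≡ actIndex n l (τ , b)
  still (inj₂ refl) = inj₂ refl
  still (inj₁ a≢b) rewrite actIndex-split n l σ a | actIndex-split n l τ b =
    inj₁ (λ e → a≢b (position-injective n l a b e))

root-form : ∀ {n} {x : Lattice n} → Root x → RootForm x
root-form {n} {x} (w , k , wσ≈x) with act-form w (simple-form k)
... | rootForm p q distinct-or-equal p<n q<n coordinates =
  rootForm p q distinct-or-equal p<n q<n (λ t t<n → trans (εOf-cong (λ j → sym (wσ≈x j)) t) (coordinates t t<n))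

εOf-zero : ∀ {n} (x : Lattice n) → (∀ j → x j ≡ + 0) → ∀ t → εOf x t ≡ + 0
εOf-zero {n} x x≡0 t = trans (toε-cong n (extend-zero x x≡0) t) (toε-0 t)
  where
  toε-0 : ∀ t → toε n (λ _ → + 0) t ≡ + 0
  toε-0 zero with 1 ≡ᵇ n
  ... | true = refl
  ... | false = refl
  toε-0 (suc t) with suc (suc t) ≡ᵇ n
  ... | true = refl
  ... | false = refl

-- The ε-coordinates of a root do not vanish at the position of p; so roots are nonzero
-- and positive roots have positive height.
form-nonzero : ∀ p q → proj₂ p ≢ proj₂ q ⊎ p ≡ q → unit p (proj₂ p) + unit q (proj₂ p) ≢ + 0
form-nonzero (σ , a) (τ , b) (inj₁ a≢b) rewrite ≡ᵇ-refl a | ≡ᵇ-false a≢b with σ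
... | true = λ ()
... | false = λ ()
form-nonzero (σ , a) _ (inj₂ refl) rewrite ≡ᵇ-refl a with σ
... | true = λ ()
... | false = λ ()

positiveRoot-height : ∀ {n} (δ : Lattice n) → PosRoot δ → + 1 ≤ ht δ
positiveRoot-height {n} δ (δ-root , δ≥0) with root-form δ-root
... | rootForm p q distinct-or-equal p<n q<n coordinates = positive (∑-nonneg δ δ≥0) height≢0
  where
  positive : ∀ {h} → + 0 ≤ h → h ≢ + 0 → + 1 ≤ h
  positive {+ zero} _ h≢0 = ⊥-elim (h≢0 refl)
  positive {+ suc k} _ _ = +≤+ (s≤s z≤n)
  height≢0 : ht δ ≢ + 0
  height≢0 ht≡0 = form-nonzero p q distinct-or-equal
    (trans (sym (coordinates (proj₂ p) p<n)) (εOf-zero δ δ≡0 (proj₂ p)))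
    where
    δ≡0 : ∀ j → δ j ≡ + 0
    δ≡0 j = ℤP.≤-antisym (subst (δ j ≤_) ht≡0 (∑-≥-term δ δ≥0 j)) (δ≥0 j)

γ₂ℕ : ℕ → ℕ → ℕ → ℤ
γ₂ℕ n I t = if suc t ≡ᵇ n then + 1 else (if t <ᵇ I then + 0 else + 2)

γ₂-ℕ : ∀ {n} (I j : Fin n) → γ₂ I j ≡ γ₂ℕ n (toℕ I) (toℕ j)
γ₂-ℕ {n} I j rewrite ≟-≡ᵇ (suc (toℕ j)) n | <?-<ᵇ (toℕ j) (toℕ I) = refl

γ₁ℕ : ℕ → ℕ → ℕ → ℕ → ℤ
γ₁ℕ n I J t = if suc t ≡ᵇ n then + 1 else (if t <ᵇ I then + 0 else (if t <ᵇ J then + 1 else + 2))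

γ₁-ℕ : ∀ {n} (I J j : Fin n) → γ₁ I J j ≡ γ₁ℕ n (toℕ I) (toℕ J) (toℕ j)
γ₁-ℕ {n} I J j rewrite ≟-≡ᵇ (suc (toℕ j)) n | <?-<ᵇ (toℕ j) (toℕ I) | <?-<ᵇ (toℕ j) (toℕ J) = refl

≤-last : ∀ {n a t} → a < n → suc t ≡ n → a ℕ.≤ t
≤-last a<n last = ℕP.≤-pred (subst (_ <_) (sym last) a<n)

γ₂-form : ∀ {n} (I : Fin n) → εPair (γ₂ I) (true , toℕ I) (true , toℕ I)
γ₂-form {n} I = toε-partialSum n (extend (γ₂ I)) (λ m → unit εI m + unit εI m) coefficient
  where
  εI : SignedIndex
  εI = (true , toℕ I)
  coefficient : ∀ t → t < n → scaleLast n t (extend (γ₂ I) t) ≡ partialSum (λ m → unit εI m + unit εI m) t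
  coefficient t t<n rewrite extend-formula (γ₂ I) (γ₂ℕ n (toℕ I)) (γ₂-ℕ I) t t<n | partialSum-+ (unit εI) (unit εI) t
    with suc t ≡ᵇ n in last?
  ... | true rewrite partialSum-unit-≥ true (toℕ I) t (≤-last (FinP.toℕ<n I) (≡ᵇ-true _ _ last?)) = refl
  ... | false with ℕP.<-cmp t (toℕ I)
  ... | tri< t<I _ _ rewrite <ᵇ-true t<I | partialSum-unit-< true (toℕ I) t t<I = refl
  ... | tri≈ _ t≡I _ rewrite <ᵇ-false (ℕP.≤-reflexive (sym t≡I)) | partialSum-unit-≥ true (toℕ I) t (ℕP.≤-reflexive (sym t≡I)) = refl
  ... | tri> _ _ I<t rewrite <ᵇ-false (ℕP.<⇒≤ I<t) | partialSum-unit-≥ true (toℕ I) t (ℕP.<⇒≤ I<t) = refl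

γ₁-form : ∀ {n} (I J : Fin n) → toℕ I < toℕ J → εPair (γ₁ I J) (true , toℕ I) (true , toℕ J)
γ₁-form {n} I J I<J = toε-partialSum n (extend (γ₁ I J)) (λ m → unit εI m + unit εJ m) coefficient
  where
  εI : SignedIndex
  εI = (true , toℕ I)
  εJ : SignedIndex
  εJ = (true , toℕ J)
  coefficient : ∀ t → t < n → scaleLast n t (extend (γ₁ I J) t) ≡ partialSum (λ m → unit εI m + unit εJ m) t
  coefficient t t<n
    rewrite extend-formula (γ₁ I J) (γ₁ℕ n (toℕ I) (toℕ J)) (γ₁-ℕ I J) t t<n | partialSum-+ (unit εI) (unit εJ) t
    with suc t ≡ᵇ n in last?
  ... | true rewrite partialSum-unit-≥ true (toℕ I) t (≤-last (FinP.toℕ<n I) (≡ᵇ-true _ _ last?))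
                   | partialSum-unit-≥ true (toℕ J) t (≤-last (FinP.toℕ<n J) (≡ᵇ-true _ _ last?)) = refl
  ... | false with ℕP.<-cmp t (toℕ I)
  ... | tri< t<I _ _ rewrite <ᵇ-true t<I | partialSum-unit-< true (toℕ I) t t<I
                           | partialSum-unit-< true (toℕ J) t (ℕP.<-trans t<I I<J) = refl
  ... | tri≈ _ refl _ rewrite <ᵇ-false (ℕP.≤-refl {toℕ I}) | partialSum-unit-≥ true (toℕ I) (toℕ I) ℕP.≤-refl
                            | <ᵇ-true I<J | partialSum-unit-< true (toℕ J) (toℕ I) I<J = refl
  ... | tri> _ _ I<t rewrite <ᵇ-false (ℕP.<⇒≤ I<t) | partialSum-unit-≥ true (toℕ I) t (ℕP.<⇒≤ I<t)
    with ℕP.<-cmp t (toℕ J)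
  ...   | tri< t<J _ _ rewrite <ᵇ-true t<J | partialSum-unit-< true (toℕ J) t t<J = refl
  ...   | tri≈ _ t≡J _ rewrite <ᵇ-false (ℕP.≤-reflexive (sym t≡J)) | partialSum-unit-≥ true (toℕ J) t (ℕP.≤-reflexive (sym t≡J)) = refl
  ...   | tri> _ _ J<t rewrite <ᵇ-false (ℕP.<⇒≤ J<t) | partialSum-unit-≥ true (toℕ J) t (ℕP.<⇒≤ J<t) = refl

γ₂-below : ∀ {n} (I j : Fin n) → suc (toℕ I) < n → toℕ j < toℕ I → γ₂ I j ≡ + 0
γ₂-below {n} I j I+1<n j<I rewrite γ₂-ℕ I j | ≡ᵇ-< (ℕP.<-trans (s≤s j<I) I+1<n) | <ᵇ-true j<I = refl

γ₂-at : ∀ {n} (I : Fin n) → suc (toℕ I) < n → γ₂ I I ≡ + 2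
γ₂-at {n} I I+1<n rewrite γ₂-ℕ I I | ≡ᵇ-< I+1<n | <ᵇ-false (ℕP.≤-refl {toℕ I}) = refl

tabulate-toℕ : ∀ {n} (f : ℕ → ℕ) → tabulate {n = n} (λ j → f (toℕ j)) ≡ applyUpTo f n
tabulate-toℕ {zero} f = refl
tabulate-toℕ {suc n} f = cong (f 0 ∷_) (tabulate-toℕ {n} (λ t → f (suc t)))

toIndices-w0 : ∀ m → toIndices (w0 (suc m)) ≡ upTo (suc m) ++ downFrom m
toIndices-w0 m = begin
  map toℕ (allFin (suc m) ++ drop 1 (reverse (allFin (suc m))))
    ≡⟨ LP.map-++ toℕ (allFin (suc m)) _ ⟩
  map toℕ (allFin (suc m)) ++ map toℕ (drop 1 (reverse (allFin (suc m))))
    ≡⟨ cong (map toℕ (allFin (suc m)) ++_) (sym (LP.drop-map 1 (reverse (allFin (suc m))))) ⟩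
  map toℕ (allFin (suc m)) ++ drop 1 (map toℕ (reverse (allFin (suc m))))
    ≡⟨ cong (λ is → map toℕ (allFin (suc m)) ++ drop 1 is) (LP.reverse-map toℕ (allFin (suc m))) ⟩
  map toℕ (allFin (suc m)) ++ drop 1 (reverse (map toℕ (allFin (suc m))))
    ≡⟨ cong (λ is → is ++ drop 1 (reverse is)) allIndices ⟩
  upTo (suc m) ++ drop 1 (reverse (upTo (suc m)))
    ≡⟨ cong (λ is → upTo (suc m) ++ drop 1 is) (LP.reverse-upTo (suc m)) ⟩
  upTo (suc m) ++ downFrom m ∎
  where
  open ≡-Reasoning
  allIndices : map toℕ (allFin (suc m)) ≡ upTo (suc m)
  allIndices = trans (LP.map-tabulate (λ j → j) toℕ) (tabulate-toℕ {suc m} (λ t → t))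

actIndex-++ : ∀ n l l′ p → actIndex n (l ++ l′) p ≡ actIndex n l (actIndex n l′ p)
actIndex-++ n [] l′ p = refl
actIndex-++ n (k ∷ l) l′ p = cong (reflectIndex n k) (actIndex-++ n l l′ p)

downFrom-moves : ∀ m j → j ℕ.≤ m → actIndex (suc m) (downFrom j) (true , 0) ≡ (true , j)
downFrom-moves m zero j≤m = refl
downFrom-moves m (suc j) j+1≤m rewrite downFrom-moves m j (ℕP.≤-trans (ℕP.n≤1+n j) j+1≤m)
  | ≡ᵇ-< (s≤s j+1≤m) | ≡ᵇ-refl j = refl

upTo-moves : ∀ m j → j ℕ.≤ m → actIndex (suc m) (upTo j) (false , j) ≡ (false , 0)
upTo-moves m zero j≤m = refl
upTo-moves m (suc j) j+1≤m = begin
  actIndex (suc m) (upTo (suc j)) (false , suc j)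
    ≡⟨ cong (λ l → actIndex (suc m) l (false , suc j)) (sym (LP.upTo-∷ʳ j)) ⟩
  actIndex (suc m) (upTo j ++ [ j ]) (false , suc j)
    ≡⟨ actIndex-++ (suc m) (upTo j) [ j ] (false , suc j) ⟩
  actIndex (suc m) (upTo j) (reflectIndex (suc m) j (false , suc j))
    ≡⟨ cong (actIndex (suc m) (upTo j)) swap ⟩
  actIndex (suc m) (upTo j) (false , j)
    ≡⟨ upTo-moves m j (ℕP.≤-trans (ℕP.n≤1+n j) j+1≤m) ⟩
  (false , 0) ∎
  where
  open ≡-Reasoning
  swap : reflectIndex (suc m) j (false , suc j) ≡ (false , j)
  swap rewrite ≡ᵇ-< (s≤s j+1≤m) | ≡ᵇ-> (ℕP.n<1+n j) | ≡ᵇ-refl j = refl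

w0-negates-ε₀ : ∀ m → actIndex (suc m) (toIndices (w0 (suc m))) (true , 0) ≡ (false , 0)
w0-negates-ε₀ m = begin
  actIndex n (toIndices (w0 n)) (true , 0)
    ≡⟨ cong (λ l → actIndex n l (true , 0)) (toIndices-w0 m) ⟩
  actIndex n (upTo n ++ downFrom m) (true , 0)
    ≡⟨ actIndex-++ n (upTo n) (downFrom m) (true , 0) ⟩
  actIndex n (upTo n) (actIndex n (downFrom m) (true , 0))
    ≡⟨ cong (actIndex n (upTo n)) (downFrom-moves m m ℕP.≤-refl) ⟩
  actIndex n (upTo n) (true , m)
    ≡⟨ cong (λ l → actIndex n l (true , m)) (sym (LP.upTo-∷ʳ m)) ⟩
  actIndex n (upTo m ++ [ m ]) (true , m)
    ≡⟨ actIndex-++ n (upTo m) [ m ] (true , m) ⟩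
  actIndex n (upTo m) (reflectIndex n m (true , m))
    ≡⟨ cong (actIndex n (upTo m)) flip ⟩
  actIndex n (upTo m) (false , m)
    ≡⟨ upTo-moves m m ℕP.≤-refl ⟩
  (false , 0) ∎
  where
  open ≡-Reasoning
  n : ℕ
  n = suc m
  flip : reflectIndex n m (true , m) ≡ (false , m)
  flip rewrite ≡ᵇ-refl m = refl

length-w0 : ∀ m → length (w0 (suc m)) ≡ suc m ℕ.+ m
length-w0 m = begin
  length (w0 (suc m))                                 ≡⟨ sym (LP.length-map toℕ (w0 (suc m))) ⟩
  length (toIndices (w0 (suc m)))                     ≡⟨ cong length (toIndices-w0 m) ⟩
  length (upTo (suc m) ++ downFrom m)                 ≡⟨ LP.length-++ (upTo (suc m)) ⟩
  length (upTo (suc m)) ℕ.+ length (downFrom m)       ≡⟨ cong₂ ℕ._+_ (LP.length-upTo (suc m)) (LP.length-downFrom m) ⟩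
  suc m ℕ.+ m                                         ∎
  where open ≡-Reasoning

βCount-⊆ : ∀ {n} {s r : Word n} → s ⊆ r → βCount n (toIndices s) ℕ.≤ βCount n (toIndices r)
βCount-⊆ [] = z≤n
βCount-⊆ (y ∷ʳ s⊆r) = ℕP.≤-trans (βCount-⊆ s⊆r) (ℕP.m≤n+m _ _)
βCount-⊆ (refl ∷ s⊆r) = ℕP.+-monoʳ-≤ _ (βCount-⊆ s⊆r)

-- Every element below w₀ in the Bruhat order is represented by a word with at most
-- one letter s_β: a reduced word for w₀ negates ε_0, which costs 2m letters s_α out
-- of its 2m + 1 letters, and a subword has no more s_β than the word itself.
below-w0-one-β : ∀ {n} → 1 < n → (w : Word n) → w ≤B w0 n →
  Σ (Word n) λ s → s ≈W w × βCount n (toIndices s) ℕ.≤ 1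
below-w0-one-β {suc m} 1<n w (r , r≈w0 , r-reduced , s , s⊆r , s≈w) =
  s , s≈w , ℕP.≤-trans (βCount-⊆ s⊆r) r-one-β
  where
  n : ℕ
  n = suc m
  l : Indices
  l = toIndices r
  r-negates-ε₀ : actIndex n l (true , 0) ≡ (false , 0)
  r-negates-ε₀ = twice-unit-0 (begin
    unit P 0 + unit P 0     ≡⟨ sym (εOf-act r (γ₂ Fin.zero) _ _ (γ₂-form Fin.zero) 0 (s≤s z≤n)) ⟩
    εOf (act r (γ₂ Fin.zero)) 0      ≡⟨ εOf-cong (r≈w0 (γ₂ Fin.zero)) 0 ⟩
    εOf (act (w0 n) (γ₂ Fin.zero)) 0 ≡⟨ εOf-act (w0 n) (γ₂ Fin.zero) _ _ (γ₂-form Fin.zero) 0 (s≤s z≤n) ⟩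
    unit Q 0 + unit Q 0     ≡⟨ cong (λ z → unit z 0 + unit z 0) (w0-negates-ε₀ m) ⟩
    - (+ 2)                 ∎)
    where
    open ≡-Reasoning
    P : SignedIndex
    P = actIndex n l (true , 0)
    Q : SignedIndex
    Q = actIndex n (toIndices (w0 n)) (true , 0)
    twice-unit-0 : ∀ {p} → unit p 0 + unit p 0 ≡ - (+ 2) → p ≡ (false , 0)
    twice-unit-0 {false , zero} _ = refl
    twice-unit-0 {true , zero} ()
    twice-unit-0 {σ , suc a} ()
  split : (signFlip n l 0 xor true , position n l 0) ≡ (false , 0)
  split = trans (sym (actIndex-split n l true 0)) r-negates-ε₀
  flipped : signFlip n l 0 ≡ true
  flipped with signFlip n l 0 | cong proj₁ split
  ... | true | _ = refl
  α-letters : m ℕ.+ m ℕ.≤ αCount n l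
  α-letters = subst (λ z → m ℕ.+ m ℕ.≤ z ℕ.+ αCount n l) (cong proj₂ split) (flip-cost n m l 0 refl flipped)
  r-length : αCount n l ℕ.+ βCount n l ℕ.≤ m ℕ.+ m ℕ.+ 1
  r-length = subst₂ ℕ._≤_ (trans (sym (LP.length-map toℕ r)) (length-αβ n l))
               (trans (length-w0 m) (trans (cong suc (ℕP.+-comm m m)) (ℕP.+-comm 1 (m ℕ.+ m))))
               (r-reduced (w0 n) (λ x j → sym (r≈w0 x j)))
  r-one-β : βCount n l ℕ.≤ 1
  r-one-β = ℕP.+-cancelˡ-≤ (m ℕ.+ m) _ _ (ℕP.≤-trans (ℕP.+-monoˡ-≤ (βCount n l) α-letters) r-length)

Neg-≈ : ∀ {n} {y z : Lattice n} → (∀ j → y j ≡ z j) → Neg y → Neg z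
Neg-≈ y≡z (y≤0 , y≢0) = (λ j → subst (_≤ + 0) (y≡z j) (y≤0 j)) , (λ z≡0 → y≢0 (λ j → trans (y≡z j) (z≡0 j)))

nonneg-not-Neg : ∀ {n} (y : Lattice n) → Nonneg y → ¬ Neg y
nonneg-not-Neg y y≥0 (y≤0 , y≢0) = y≢0 (λ j → ℤP.≤-antisym (y≤0 j) (y≥0 j))

NegatesOnly : ∀ {n} → Word n → ℕ → Set
NegatesOnly {n} s a = signFlip n (toIndices s) a ≡ true × (∀ c → c ≢ a → signFlip n (toIndices s) c ≡ false)

-- If w ≤ w₀ makes γ₂ = 2ε_I negative, then w negates ε_I, and (having at most one
-- s_β) no other ε_c.
negates-only : ∀ {n} → 1 < n → (I : Fin n) (w : Word n) → w ≤B w0 n → Neg (act w (γ₂ I)) →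
  Σ (Word n) λ s → s ≈W w × NegatesOnly s (toℕ I)
negates-only {n} 1<n I w w≤w0 wγ₂<0 with below-w0-one-β 1<n w w≤w0
... | s , s≈w , one-β = s , s≈w , I-flips , λ c c≢I → flip-unique n l (toℕ I) c one-β (λ e → c≢I (sym e)) I-flips
  where
  l : Indices
  l = toIndices s
  I-flips : signFlip n l (toℕ I) ≡ true
  I-flips with signFlip n l (toℕ I) in kept
  ... | true = refl
  ... | false = ⊥-elim (nonneg-not-Neg (act s (γ₂ I)) (proj₁ (positive-εPair (act s (γ₂ I)) I′<n I′<n sγ₂-form))
                          (Neg-≈ (λ j → sym (s≈w (γ₂ I) j)) wγ₂<0))
    where
    I′<n : position n l (toℕ I) < n
    I′<n = position-< s (toℕ I) (FinP.toℕ<n I)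
    image : actIndex n l (true , toℕ I) ≡ (true , position n l (toℕ I))
    image = trans (actIndex-split n l true (toℕ I)) (cong (λ f → f xor true , position n l (toℕ I)) kept)
    sγ₂-form : εPair (act s (γ₂ I)) (true , position n l (toℕ I)) (true , position n l (toℕ I))
    sγ₂-form t t<n = trans (εOf-act s (γ₂ I) _ _ (γ₂-form I) t t<n) (cong (λ p → unit p t + unit p t) image)

negates-only-Neg : ∀ {n} {s : Word n} {a c} (x : Lattice n) → NegatesOnly s a → a < n → c < n → c ≢ a →
  εPair x (true , a) (false , c) → Neg (act s x)
negates-only-Neg {n} {s} {a} {c} x (a-flips , others-kept) a<n c<n c≢a x-form =
  negative-εPair (act s x) (position-< s a a<n) (position-< s c c<n) image-form
  where
  l : Indices
  l = toIndices s
  image-a : actIndex n l (true , a) ≡ (false , position n l a)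
  image-a = trans (actIndex-split n l true a) (cong (λ f → f xor true , position n l a) a-flips)
  image-c : actIndex n l (false , c) ≡ (false , position n l c)
  image-c = trans (actIndex-split n l false c) (cong (λ f → f xor false , position n l c) (others-kept c c≢a))
  image-form : εPair (act s x) (false , position n l a) (false , position n l c)
  image-form t t<n = trans (εOf-act s x _ _ x-form t t<n) (cong₂ (λ p q → unit p t + unit q t) image-a image-c)

εOf-below : ∀ {n} (x : Lattice n) (I : Fin n) → suc (toℕ I) < n → (∀ j → toℕ j < toℕ I → x j ≡ + 0) →
  (∀ t → t < toℕ I → εOf x t ≡ + 0) × εOf x (toℕ I) ≡ x I
εOf-below {n} x I I+1<n x-below = below , at
  where
  ι : ℕ
  ι = toℕ I
  X-below : ∀ t → t < ι → extend x t ≡ + 0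
  X-below t t<ι = trans (extend-fromℕ< x t<n) (x-below _ (subst (_< ι) (sym (FinP.toℕ-fromℕ< t<n)) t<ι))
    where
    t<n : t < n
    t<n = ℕP.<-trans t<ι (FinP.toℕ<n I)
  prev-below : ∀ t → t ℕ.≤ ι → prev (extend x) t ≡ + 0
  prev-below zero _ = refl
  prev-below (suc t) t<ι = X-below t t<ι
  not-last : ∀ t → t ℕ.≤ ι → (suc t ≡ᵇ n) ≡ false
  not-last t t≤ι = ≡ᵇ-< (ℕP.≤-<-trans (s≤s t≤ι) I+1<n)
  below : ∀ t → t < ι → εOf x t ≡ + 0
  below t t<ι rewrite not-last t (ℕP.<⇒≤ t<ι) | X-below t t<ι | prev-below t (ℕP.<⇒≤ t<ι) = refl
  at : εOf x ι ≡ x I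
  at rewrite not-last ι ℕP.≤-refl | prev-below ι ℕP.≤-refl = trans (ℤP.+-identityʳ _) (extend-toℕ x I)

data LeadsAt {n} (x : Lattice n) (I : ℕ) : Set where
  ε-minus : ∀ c → I < c → c < n → εPair x (true , I) (false , c) → LeadsAt x I
  ε-plus : ∀ c → c < n → εPair x (true , I) (true , c) → LeadsAt x I

unit-≤1 : ∀ p t → unit p t ≤ + 1
unit-≤1 (σ , a) t with t ≡ᵇ a | σ
... | true | true = ℤP.≤-refl
... | true | false = -≤+
... | false | _ = +≤+ z≤n

1≰0 : ¬ (+ 1 ≤ + 0)
1≰0 (+≤+ ())

1≰-1 : ¬ (+ 1 ≤ - (+ 1))
1≰-1 ()

unit-self : ∀ σ a → unit (σ , a) a ≡ sign σ
unit-self σ a rewrite ≡ᵇ-refl a = refl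

unit-other : ∀ p t → t ≢ proj₂ p → unit p t ≡ + 0
unit-other p t t≢a rewrite ≡ᵇ-false t≢a = refl

leads-with : ∀ {n} {x : Lattice n} I τ b → I < n → b < n → εPair x (true , I) (τ , b) →
  (∀ t → t < I → εOf x t ≡ + 0) → + 1 ≤ εOf x I → LeadsAt x I
leads-with I true b _ b<n x-form _ _ = ε-plus b b<n x-form
leads-with {n} {x} I false b I<n b<n x-form x-below x-at with ℕP.<-cmp b I
... | tri> _ _ I<b = ε-minus b I<b b<n x-form
... | tri< b<I _ _
  with () ← trans (sym (x-below b b<I))
              (trans (x-form b b<n) (cong₂ _+_ (unit-other (true , I) b (ℕP.<⇒≢ b<I)) (unit-self false b)))
... | tri≈ _ refl _ =
  ⊥-elim (1≰0 (subst (+ 1 ≤_) (trans (x-form b b<n) (cong₂ _+_ (unit-self true b) (unit-self false b))) x-at))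

leads-at : ∀ {n} {x : Lattice n} I → I < n → RootForm x →
  (∀ t → t < I → εOf x t ≡ + 0) → + 1 ≤ εOf x I → LeadsAt x I
leads-at {n} {x} I I<n (rootForm (σ , a) (τ , b) _ a<n b<n x-form) x-below x-at
  with a ℕ.≟ I | b ℕ.≟ I
... | yes refl | _ with σ
...   | true = leads-with I τ b I<n b<n x-form x-below x-at
...   | false = ⊥-elim (1≰0 (ℤP.≤-trans (subst (+ 1 ≤_) (x-form I I<n) x-at)
          (subst (_≤ + 0) (cong (_+ unit (τ , b) I) (sym (unit-self false I)))
            (ℤP.≤-trans (ℤP.+-monoʳ-≤ (- (+ 1)) (unit-≤1 (τ , b) I)) (+≤+ z≤n)))))
leads-at {n} {x} I I<n (rootForm (σ , a) (τ , b) _ a<n b<n x-form) x-below x-at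
    | no a≢I | yes refl with τ
...   | true = leads-with I σ a I<n a<n (λ t t<n → trans (x-form t t<n) (ℤP.+-comm (unit (σ , a) t) (unit (true , I) t))) x-below x-at
...   | false = ⊥-elim (1≰-1 (subst (+ 1 ≤_)
          (trans (x-form I I<n) (cong₂ _+_ (unit-other (σ , a) I (λ e → a≢I (sym e))) (unit-self false I))) x-at))
leads-at {n} {x} I I<n (rootForm (σ , a) (τ , b) _ a<n b<n x-form) x-below x-at
    | no a≢I | no b≢I = ⊥-elim (1≰0 (subst (+ 1 ≤_)
          (trans (x-form I I<n) (cong₂ _+_ (unit-other (σ , a) I (λ e → a≢I (sym e)))
                                           (unit-other (τ , b) I (λ e → b≢I (sym e))))) x-at))

twice-at : ∀ {n} {x : Lattice n} I → I < n → RootForm x → εOf x I ≡ + 2 → εPair x (true , I) (true , I)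
twice-at {n} {x} I I<n (rootForm (σ , a) (τ , b) _ a<n b<n x-form) x-at
  with a ℕ.≟ I | b ℕ.≟ I | trans (sym (x-form I I<n)) x-at
... | yes refl | yes refl | at-I rewrite ≡ᵇ-refl a with σ | τ | at-I
...   | true | true | _ = x-form
...   | true | false | ()
...   | false | true | ()
...   | false | false | ()
twice-at I I<n (rootForm (σ , a) (τ , b) _ a<n b<n x-form) x-at | yes refl | no b≢I | at-I
  rewrite ≡ᵇ-refl a | ≡ᵇ-false (λ e → b≢I (sym e)) with σ | at-I
... | true | ()
... | false | ()
twice-at I I<n (rootForm (σ , a) (τ , b) _ a<n b<n x-form) x-at | no a≢I | yes refl | at-I
  rewrite ≡ᵇ-refl b | ≡ᵇ-false (λ e → a≢I (sym e)) with τ | at-I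
... | true | ()
... | false | ()
twice-at I I<n (rootForm (σ , a) (τ , b) _ a<n b<n x-form) x-at | no a≢I | no b≢I | at-I
  rewrite ≡ᵇ-false (λ e → a≢I (sym e)) | ≡ᵇ-false (λ e → b≢I (sym e)) with at-I
... | ()

toε-+- : ∀ n (X Y Z : ℕ → ℤ) t → toε n (λ m → X m + Y m - Z m) t ≡ toε n X t + toε n Y t - toε n Z t
toε-+- n X Y Z zero with 1 ≡ᵇ n
... | true = ring (X 0) (Y 0) (Z 0)
  where
  ring : ∀ a b c → a + b - c + (a + b - c) - + 0 ≡ a + a - + 0 + (b + b - + 0) - (c + c - + 0)
  ring = solve-∀
... | false = ring (X 0) (Y 0) (Z 0)
  where
  ring : ∀ a b c → a + b - c - + 0 ≡ a - + 0 + (b - + 0) - (c - + 0)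
  ring = solve-∀
toε-+- n X Y Z (suc t) with suc (suc t) ≡ᵇ n
... | true = ring (X (suc t)) (Y (suc t)) (Z (suc t)) (X t) (Y t) (Z t)
  where
  ring : ∀ a b c a' b' c' → a + b - c + (a + b - c) - (a' + b' - c') ≡ a + a - a' + (b + b - b') - (c + c - c')
  ring = solve-∀
... | false = ring (X (suc t)) (Y (suc t)) (Z (suc t)) (X t) (Y t) (Z t)
  where
  ring : ∀ a b c a' b' c' → a + b - c - (a' + b' - c') ≡ a - a' + (b - b') - (c - c')
  ring = solve-∀

εOf-+- : ∀ {n} (x y z : Lattice n) t → εOf (λ j → x j + y j - z j) t ≡ εOf x t + εOf y t - εOf z t
εOf-+- {n} x y z t = trans (toε-cong n extend-+- t) (toε-+- n (extend x) (extend y) (extend z) t)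
  where
  extend-+- : ∀ m → extend (λ j → x j + y j - z j) m ≡ extend x m + extend y m - extend z m
  extend-+- m = trans (extend-zipWith _-_ refl (λ j → x j + y j) z m)
                      (cong (_- extend z m) (extend-zipWith _+_ refl x y m))

-- A summand δ = ε_I + ε_c would be too high: δ + γ₁ - γ₂ = ε_c + ε_J has positive height.
plus-form-height : ∀ {n} (I J : Fin n) → toℕ I < toℕ J → (δ : Lattice n) {c : ℕ} → c < n →
  εPair δ (true , toℕ I) (true , c) → + 1 ≤ ht δ + ht (γ₁ I J) - ht (γ₂ I)
plus-form-height {n} I J I<J δ {c} c<n δ-form = subst (+ 1 ≤_) height-z (proj₂ (positive-εPair z c<n (FinP.toℕ<n J) z-form))
  where
  z : Lattice n
  z j = δ j + γ₁ I J j - γ₂ I j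
  z-form : εPair z (true , c) (true , toℕ J)
  z-form t t<n = begin
    εOf z t                                                  ≡⟨ εOf-+- δ (γ₁ I J) (γ₂ I) t ⟩
    εOf δ t + εOf (γ₁ I J) t - εOf (γ₂ I) t
      ≡⟨ cong₂ _-_ (cong₂ _+_ (δ-form t t<n) (γ₁-form I J I<J t t<n)) (γ₂-form I t t<n) ⟩
    εI + unit (true , c) t + (εI + unit (true , toℕ J) t) - (εI + εI)
      ≡⟨ cancel εI (unit (true , c) t) (unit (true , toℕ J) t) ⟩
    unit (true , c) t + unit (true , toℕ J) t                ∎
    where
    open ≡-Reasoning
    εI : ℤ
    εI = unit (true , toℕ I) t
    cancel : ∀ a b c → a + b + (a + c) - (a + a) ≡ b + c
    cancel = solve-∀
  height-z : ht z ≡ ht δ + ht (γ₁ I J) - ht (γ₂ I)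
  height-z = trans (∑-- (λ j → δ j + γ₁ I J j) (γ₂ I)) (cong (_- ht (γ₂ I)) (∑-+ δ (γ₁ I J)))

sumL-nonneg : ∀ {n} {δs : List (Lattice n)} → All Nonneg δs → Nonneg (sumL δs)
sumL-nonneg [] j = +≤+ z≤n
sumL-nonneg (δ≥0 ∷ δs≥0) j = ℤP.+-mono-≤ (δ≥0 j) (sumL-nonneg δs≥0 j)

summand-≤ : ∀ {n} {δ : Lattice n} {δs} → All Nonneg δs → δ ∈ δs → ∀ j → δ j ≤ sumL δs j
summand-≤ {δs = δ ∷ δs} (_ ∷ δs≥0) (here refl) j =
  ℤP.≤-trans (ℤP.≤-reflexive (sym (ℤP.+-identityʳ (δ j)))) (ℤP.+-monoʳ-≤ (δ j) (sumL-nonneg δs≥0 j))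
summand-≤ {δs = δ′ ∷ δs} (δ′≥0 ∷ δs≥0) (there δ∈δs) j =
  ℤP.≤-trans (summand-≤ δs≥0 δ∈δs j)
    (ℤP.≤-trans (ℤP.≤-reflexive (sym (ℤP.+-identityˡ (sumL δs j)))) (ℤP.+-monoˡ-≤ (sumL δs j) (δ′≥0 j)))

index-below : ∀ {n} {I J : Fin n} → toℕ I < toℕ J → suc (toℕ I) < n
index-below {J = J} I<J = ℕP.<-≤-trans (s≤s I<J) (FinP.toℕ<n J)

ξ-from-sum : ∀ {n} {I : Fin n} {ξ : Lattice n} {δs} → (∀ k → sumL δs k ≡ γ₂ I k - ξ k) →
  ∀ k → ξ k ≡ γ₂ I k - sumL δs k
ξ-from-sum {I = I} {ξ} {δs} sum≡ k = trans (solve (γ₂ I k) (ξ k)) (cong (λ y → γ₂ I k - y) (sym (sum≡ k)))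
  where
  solve : ∀ a x → x ≡ a - (a - x)
  solve = solve-∀

sum-height : ∀ {n} {I : Fin n} {ξ : Lattice n} {δs} → (∀ k → sumL δs k ≡ γ₂ I k - ξ k) →
  ht (sumL δs) ≡ ht (γ₂ I) - ht ξ
sum-height {I = I} {ξ} sum≡ = trans (∑-cong sum≡) (∑-- (γ₂ I) ξ)

-- Since γ₂ has no coefficient below I, neither does any summand.
summands-below-I : ∀ {n} (I : Fin n) → suc (toℕ I) < n → {ξ : Lattice n} → Nonneg ξ →
  {δs : List (Lattice n)} → All Nonneg δs → (∀ k → sumL δs k ≡ γ₂ I k - ξ k) →
  ∀ {δ} → δ ∈ δs → ∀ j → toℕ j < toℕ I → δ j ≡ + 0
summands-below-I I I+1<n {ξ} ξ≥0 δs≥0 sum≡ δ∈δs j j<I =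
  ℤP.≤-antisym (ℤP.≤-trans (summand-≤ δs≥0 δ∈δs j)
                 (ℤP.≤-trans (ℤP.≤-reflexive (trans (sum≡ j) (cong (_- ξ j) (γ₂-below I j I+1<n j<I))))
                             (subst (_≤ + 0) (sym (ℤP.+-identityˡ (- ξ j))) (ℤP.neg-mono-≤ (ξ≥0 j)))))
               (All.lookup δs≥0 δ∈δs j)

summand-height : ∀ {n} {I : Fin n} {ξ : Lattice n} {δs : List (Lattice n)} → All Nonneg δs →
  (∀ k → sumL δs k ≡ γ₂ I k - ξ k) → ∀ {δ} → δ ∈ δs → ht δ ≤ ht (γ₂ I) - ht ξ
summand-height {δs = δs} δs≥0 sum≡ δ∈δs = subst (_ ≤_) (sum-height {δs = δs} sum≡) (∑-mono (summand-≤ δs≥0 δ∈δs))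

-- A summand δ with δ_I ≥ 1 is ε_I - ε_c (c > I), which w negates: the alternative
-- ε_I + ε_c is too high for the height bound ht δ ≤ ht γ₂ - ht ξ ≤ ht γ₂ - ht γ₁.
summand-negated : ∀ {n} (I J : Fin n) → toℕ I < toℕ J → (s w : Word n) → s ≈W w → NegatesOnly s (toℕ I) →
  {ξ : Lattice n} → ht (γ₁ I J) ≤ ht ξ → (δ : Lattice n) → PosRoot δ →
  (∀ j → toℕ j < toℕ I → δ j ≡ + 0) → + 1 ≤ δ I → ht δ ≤ ht (γ₂ I) - ht ξ → Neg (act w δ)
summand-negated I J I<J s w s≈w negates {ξ} γ₁≤ξ δ (δ-root , _) δ-below δI≥1 δ≤γ₂-ξ
  with εOf-below δ I (index-below I<J) δ-below
... | below , at with leads-at (toℕ I) (FinP.toℕ<n I) (root-form δ-root) below (subst (+ 1 ≤_) (sym at) δI≥1)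
... | ε-minus c I<c c<n δ-form =
  Neg-≈ (s≈w δ) (negates-only-Neg {s = s} δ negates (FinP.toℕ<n I) c<n (ℕP.>⇒≢ I<c) δ-form)
... | ε-plus c c<n δ-form =
  ⊥-elim (1≰0 (ℤP.≤-trans (plus-form-height I J I<J δ c<n δ-form) (height-budget δ≤γ₂-ξ γ₁≤ξ)))
  where
  height-budget : ∀ {a g₁ g₂ x} → a ≤ g₂ - x → g₁ ≤ x → a + g₁ - g₂ ≤ + 0
  height-budget {a} {g₁} {g₂} {x} a≤ g₁≤ =
    ℤP.≤-trans (ℤP.+-monoˡ-≤ (- g₂) (ℤP.+-mono-≤ a≤ g₁≤)) (ℤP.≤-reflexive (cancel g₂ x))
    where
    cancel : ∀ g x → g - x + x - g ≡ + 0
    cancel = solve-∀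

some-member : ∀ {A : Set} {xs : List A} → xs ≢ [] → Σ A (_∈ xs)
some-member {xs = []} []≢[] = ⊥-elim ([]≢[] refl)
some-member {xs = x ∷ _} _ = x , here refl

-- If every summand vanished at I, then ξ_I = 2 and ξ would be the root 2ε_I = γ₂,
-- leaving nothing for the nonempty sum of positive roots.
some-summand-at-I : ∀ {n} (I : Fin n) → suc (toℕ I) < n → (ξ : Lattice n) → PosRoot ξ →
  (δs : List (Lattice n)) → δs ≢ [] → All PosRoot δs → (∀ k → sumL δs k ≡ γ₂ I k - ξ k) →
  Any (λ δ → + 1 ≤ δ I) δs
some-summand-at-I {n} I I+1<n ξ (ξ-root , ξ≥0) δs δs≢[] δs⁺ sum≡ with any? (λ δ → + 1 ℤ.≤? δ I) δs
... | yes hit = hit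
... | no miss with some-member δs≢[]
... | d , d∈δs = ⊥-elim (1≰0 (ℤP.≤-trans (positiveRoot-height d (All.lookup δs⁺ d∈δs)) d-height))
  where
  δs≥0 : All Nonneg δs
  δs≥0 = All.map proj₂ δs⁺
  sum-at-I : sumL δs I ≡ + 0
  sum-at-I = vanish δs (All.zip (δs≥0 , ¬Any⇒All¬ δs miss))
    where
    vanish : ∀ ds → All (λ δ → Nonneg δ × ¬ (+ 1 ≤ δ I)) ds → sumL ds I ≡ + 0
    vanish [] [] = refl
    vanish (d ∷ ds) ((d≥0 , d≱1) ∷ rest) rewrite vanish ds rest = zero-at (d≥0 I) d≱1
      where
      zero-at : ∀ {h} → + 0 ≤ h → ¬ (+ 1 ≤ h) → h + + 0 ≡ + 0
      zero-at {+ zero} _ _ = refl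
      zero-at {+ suc k} _ h≱1 = ⊥-elim (h≱1 (+≤+ (s≤s z≤n)))
  ξ-below : ∀ j → toℕ j < toℕ I → ξ j ≡ + 0
  ξ-below j j<I = ℤP.≤-antisym
    (subst (_≤ + 0) (sym (trans (ξ-from-sum {δs = δs} sum≡ j) (cong (_- sumL δs j) (γ₂-below I j I+1<n j<I))))
           (subst (_≤ + 0) (sym (ℤP.+-identityˡ (- sumL δs j))) (ℤP.neg-mono-≤ (sumL-nonneg δs≥0 j))))
    (ξ≥0 j)
  ξ-at-I : ξ I ≡ + 2
  ξ-at-I = trans (ξ-from-sum {δs = δs} sum≡ I) (cong₂ _-_ (γ₂-at I I+1<n) sum-at-I)
  ξ≡γ₂ : ∀ j → ξ j ≡ γ₂ I j
  ξ≡γ₂ with εOf-below ξ I I+1<n ξ-below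
  ... | _ , at = εOf-injective ξ (γ₂ I) λ t t<n →
    trans (twice-at (toℕ I) (FinP.toℕ<n I) (root-form ξ-root) (trans at ξ-at-I) t t<n) (sym (γ₂-form I t t<n))
  sum-height-0 : ht (sumL δs) ≡ + 0
  sum-height-0 = trans (sum-height {δs = δs} sum≡) (trans (cong (λ h → ht (γ₂ I) - h) (∑-cong ξ≡γ₂)) (ℤP.+-inverseʳ (ht (γ₂ I))))
  d-height : ht d ≤ + 0
  d-height = subst (ht d ≤_) sum-height-0 (∑-mono (summand-≤ δs≥0 d∈δs))

-- Lemma 3.7.  Only w(γ₂) < 0 and ht γ₁ ≤ ht ξ are needed.
lemma3p7 : (n : ℕ) → 1 < n → (i j : Fin n) → i Fin.< j →
    (w : Word n) → w ≤B w0 n → Neg (act w (γ₁ i j)) → Neg (act w (γ₂ i)) →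
    (ξ : Lattice n) → PosRoot ξ → ht (γ₁ i j) ≤ ht ξ → ht ξ ≤ ht (γ₂ i) →
    (δs : List (Lattice n)) → δs ≢ [] → All PosRoot δs →
    (∀ k → sumL δs k ≡ γ₂ i k - ξ k) →
    Any (λ δ → Neg (act w δ)) δs
lemma3p7 n 1<n I J I<J w w≤w0 _ wγ₂<0 ξ ξ⁺ γ₁≤ξ _ δs δs≢[] δs⁺ sum≡
  with negates-only 1<n I w w≤w0 wγ₂<0
     | find (some-summand-at-I I (index-below I<J) ξ ξ⁺ δs δs≢[] δs⁺ sum≡)
... | s , s≈w , negates | δ , δ∈δs , δI≥1 =
  lose δ∈δs (summand-negated I J I<J s w s≈w negates γ₁≤ξ δ (All.lookup δs⁺ δ∈δs)
               (summands-below-I I (index-below I<J) (proj₂ ξ⁺) δs≥0 sum≡ δ∈δs) δI≥1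
               (summand-height δs≥0 sum≡ δ∈δs))
  where
  δs≥0 : All Nonneg δs
  δs≥0 = All.map proj₂ δs⁺
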